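{- Suppose $P$ is a diamond transitive balanced colorable thin poset, and $F:P\to\mathcal{A}$ is a (covariant) functor to an abelian category $\mathcal{A}$. Given an upper order ideal $I$ in $P$, there is a long exact sequence \[\dots \to H^*(I,\mathcal{A},F|_I)\to H^*(P,\mathcal{A},F)\to H^*(P\setminus I,\mathcal{A},F|_{P\setminus I})\xrightarrow{d} H^*(I,\mathcal{A},F|_I)\to\dots\] where the connecting map $d$ has degree 1.
   Context: All posets are finite. A graded poset $P$ is thin if every closed nonempty interval of length 2 has exactly 4 elements (a "diamond"). A diamond move on a saturated chain $C$ replaces one side $x\lessdot a\lessdot y$ of a diamond $\{x,a,b,y\}$ contained in $C$ by the other side $x\lessdot b\lessdot y$; $P$ is diamond transitive if for every $x\le y$ any two maximal chains of $[x,y]$ are related by a sequence of diamond moves. A balanced coloring of $P$ is a function $c$ from the set of cover relations of $P$ to $\{1,-1\}$ such that each diamond has an odd number of edges colored $-1$; $P$ is balanced colorable if one exists. Given a balanced coloring $c$ and a covariant functor $F:P\to\mathcal{A}$, the cochain complex $C^*(P,\mathcal{A},F,c)$ has $C^k=\bigoplus_{\mathrm{rk}(x)=k}F(x)$ and differential $\delta^k=\sum_{x\lessdot y,\ \mathrm{rk}(x)=k}c(x\lessdot y)F(x\lessdot y)$; its cohomology is denoted $H^*(P,\mathcal{A},F,c)$, and is written $H^*(P,\mathcal{A},F)$ since (for diamond transitive posets with $\hat 0$) it is independent of the balanced coloring $c$ up to isomorphism. An upper order ideal $I$ is a subset such that $x\in I$ and $y\ge x$ imply $y\in I$. For an upper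 or lower order ideal $I$, $I$ is a thin poset, the restriction of $c$ to the cover relations of $I$ is a balanced coloring of $I$, and the restriction $F|_I:I\to\mathcal{A}$ is a functor; if $I$ is an upper order ideal, $C^*(I,\mathcal{A},F|_I,c|_I)$ is a subcomplex of $C^*(P,\mathcal{A},F,c)$ (the inclusion is a chain map). -}

module Defs where

open import Level using (Level; _⊔_) renaming (suc to lsuc; zero to lzero)
open import Data.Nat using (ℕ; zero; suc; _≡ᵇ_)
open import Data.Bool using (Bool; true; false; T; _∧_; not)
open import Data.Fin using (Fin; _≟_)
open import Data.Fin.Properties using (all?)
open import Data.List using (List; []; _∷_; length; lookup; filterᵇ; allFin)
open import Data.Product using (Σ; _×_; _,_; proj₁; proj₂)
open import Data.Sign using (Sign) renaming (+ to ⊕s; - to ⊖s; _*_ to _*s_)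
open import Relation.Nullary using (¬_; Dec; yes; no)
open import Relation.Nullary.Decidable using (_×-dec_; ¬?)
open import Relation.Binary.PropositionalEquality using (_≡_; _≢_; refl)
open import Relation.Binary.Construct.Closure.ReflexiveTransitive using (Star)
open import Algebra.Structures using (IsAbelianGroup)

record Preadditive (o ℓ e : Level) : Set (lsuc (o ⊔ ℓ ⊔ e)) where
  infix  4 _≈_
  infixr 9 _∘_
  infixl 6 _+_
  field
    Obj  : Set o
    Hom  : Obj → Obj → Set ℓ
    _≈_  : ∀ {A B} → Hom A B → Hom A B → Set e
    id   : ∀ {A} → Hom A A
    _∘_  : ∀ {A B C} → Hom B C → Hom A B → Hom A C
    assoc     : ∀ {A B C D} {f : Hom A B} {g : Hom B C} {h : Hom C D} →
                (h ∘ g) ∘ f ≈ h ∘ (g ∘ f)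
    identityˡ : ∀ {A B} {f : Hom A B} → id ∘ f ≈ f
    identityʳ : ∀ {A B} {f : Hom A B} → f ∘ id ≈ f
    ∘-resp-≈  : ∀ {A B C} {f h : Hom B C} {g i : Hom A B} →
                f ≈ h → g ≈ i → f ∘ g ≈ h ∘ i
    _+_  : ∀ {A B} → Hom A B → Hom A B → Hom A B
    0h   : ∀ {A B} → Hom A B
    -_   : ∀ {A B} → Hom A B → Hom A B
    +-isAbelianGroup : ∀ {A B} → IsAbelianGroup (_≈_ {A} {B}) _+_ 0h -_
    ∘-distribˡ : ∀ {A B C} {f : Hom B C} {g h : Hom A B} →
                 f ∘ (g + h) ≈ (f ∘ g) + (f ∘ h)
    ∘-distribʳ : ∀ {A B C} {f : Hom A B} {g h : Hom B C} →
                 (g + h) ∘ f ≈ (g ∘ f) + (h ∘ f)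

module PreadditiveDefs {o ℓ e} (𝒞 : Preadditive o ℓ e) where
  open Preadditive 𝒞

  Mono : ∀ {A B} → Hom A B → Set (o ⊔ ℓ ⊔ e)
  Mono {A} f = ∀ {X} (g h : Hom X A) → f ∘ g ≈ f ∘ h → g ≈ h

  Epi : ∀ {A B} → Hom A B → Set (o ⊔ ℓ ⊔ e)
  Epi {B = B} f = ∀ {X} (g h : Hom B X) → g ∘ f ≈ h ∘ f → g ≈ h

  record IsKernel {A B K} (f : Hom A B) (k : Hom K A) : Set (o ⊔ ℓ ⊔ e) where
    field
      comm      : f ∘ k ≈ 0h
      universal : ∀ {X} (g : Hom X A) → f ∘ g ≈ 0h →
                  Σ (Hom X K) λ u → (k ∘ u ≈ g) × (∀ v → k ∘ v ≈ g → v ≈ u)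

  record IsCokernel {A B Q} (f : Hom A B) (q : Hom B Q) : Set (o ⊔ ℓ ⊔ e) where
    field
      comm      : q ∘ f ≈ 0h
      universal : ∀ {X} (g : Hom B X) → g ∘ f ≈ 0h →
                  Σ (Hom Q X) λ u → (u ∘ q ≈ g) × (∀ v → v ∘ q ≈ g → v ≈ u)

  record Kernel {A B} (f : Hom A B) : Set (o ⊔ ℓ ⊔ e) where
    field
      Ker      : Obj
      arrow    : Hom Ker A
      isKernel : IsKernel f arrow

  record Cokernel {A B} (f : Hom A B) : Set (o ⊔ ℓ ⊔ e) where
    field
      Coker      : Obj
      arrow      : Hom B Coker
      isCokernel : IsCokernel f arrow

  hsum : ∀ {A B} (m : ℕ) → (Fin m → Hom A B) → Hom A B
  hsum zero    f = 0h
  hsum (suc m) f = f Fin.zero + hsum m (λ i → f (Fin.suc i))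
    where import Data.Fin as Fin

  sgn : ∀ {A B} → Sign → Hom A B → Hom A B
  sgn ⊕s f = f
  sgn ⊖s f = - f

record Abelian (o ℓ e : Level) : Set (lsuc (o ⊔ ℓ ⊔ e)) where
  field
    preadditive : Preadditive o ℓ e
  open Preadditive preadditive public
  open PreadditiveDefs preadditive public
  infixr 6 _⊕_
  field
    𝟘          : Obj
    𝟘-initial  : ∀ {A} (f : Hom 𝟘 A) → f ≈ 0h
    𝟘-terminal : ∀ {A} (f : Hom A 𝟘) → f ≈ 0h
    _⊕_ : Obj → Obj → Obj
    ι₁  : ∀ {A B} → Hom A (A ⊕ B)
    ι₂  : ∀ {A B} → Hom B (A ⊕ B)
    π₁  : ∀ {A B} → Hom (A ⊕ B) A
    π₂  : ∀ {A B} → Hom (A ⊕ B) B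
    π₁ι₁ : ∀ {A B} → π₁ ∘ ι₁ {A} {B} ≈ id
    π₂ι₂ : ∀ {A B} → π₂ ∘ ι₂ {A} {B} ≈ id
    π₁ι₂ : ∀ {A B} → π₁ ∘ ι₂ {A} {B} ≈ 0h
    π₂ι₁ : ∀ {A B} → π₂ ∘ ι₁ {A} {B} ≈ 0h
    ιπ   : ∀ {A B} → (ι₁ ∘ π₁) + (ι₂ ∘ π₂) ≈ id {A ⊕ B}
    kernel   : ∀ {A B} (f : Hom A B) → Kernel f
    cokernel : ∀ {A B} (f : Hom A B) → Cokernel f
    mono-normal : ∀ {A B} (f : Hom A B) → Mono f →
                  Σ Obj λ C → Σ (Hom B C) λ g → IsKernel g f
    epi-normal  : ∀ {A B} (f : Hom A B) → Epi f →
                  Σ Obj λ C → Σ (Hom C A) λ g → IsCokernel g f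

module AbelianDefs {o ℓ e} (𝒜 : Abelian o ℓ e) where
  open Abelian 𝒜

  ImObj : ∀ {A B} → Hom A B → Obj
  ImObj f = Kernel.Ker (kernel (Cokernel.arrow (cokernel f)))

  im : ∀ {A B} (f : Hom A B) → Hom (ImObj f) B
  im f = Kernel.arrow (kernel (Cokernel.arrow (cokernel f)))

  -- A --f--> B --g--> C is exact at B : im f = ker g as subobjects of B
  Exact : ∀ {A B C} → Hom A B → Hom B C → Set (ℓ ⊔ e)
  Exact f g =
    Σ (Hom (ImObj f) (Kernel.Ker (kernel g))) λ u →
    Σ (Hom (Kernel.Ker (kernel g)) (ImObj f)) λ v →
      (Kernel.arrow (kernel g) ∘ u ≈ im f) × (im f ∘ v ≈ Kernel.arrow (kernel g))

  -- Cochain complexes indexed by ℕ (C^k = 0 for k < 0)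
  module _ (C : ℕ → Obj) (δ : ∀ k → Hom (C k) (C (suc k))) where

    Cin : ℕ → Obj
    Cin zero    = 𝟘
    Cin (suc k) = C k

    δin : ∀ k → Hom (Cin k) (C k)
    δin zero    = 0h
    δin (suc k) = δ k

    -- A cohomology object H^k with its defining data:
    -- z : Z → C^k a kernel of δ^k, u : C^{k-1} → Z the factorisation of
    -- δ^{k-1} through z, and p : Z → H a cokernel of u.
    record CohomologyAt (k : ℕ) : Set (o ⊔ ℓ ⊔ e) where
      field
        H     : Obj
        Z     : Obj
        z     : Hom Z (C k)
        z-ker : IsKernel (δ k) z
        u     : Hom (Cin k) Z
        u-fac : z ∘ u ≈ δin k
        p     : Hom Z H
        p-cok : IsCokernel u p

  Induced : ∀ {C D : ℕ → Obj} {δC δD} {k} (f : Hom (C k) (D k)) →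
            (hC : CohomologyAt C δC k) (hD : CohomologyAt D δD k) →
            Hom (CohomologyAt.H hC) (CohomologyAt.H hD) → Set (ℓ ⊔ e)
  Induced f hC hD m =
    Σ (Hom (CohomologyAt.Z hC) (CohomologyAt.Z hD)) λ w →
      (CohomologyAt.z hD ∘ w ≈ f ∘ CohomologyAt.z hC) ×
      (m ∘ CohomologyAt.p hC ≈ CohomologyAt.p hD ∘ w)

record FinPoset : Set where
  field
    n          : ℕ
    le         : Fin n → Fin n → Bool
    le-refl    : ∀ x → T (le x x)
    le-antisym : ∀ {x y} → T (le x y) → T (le y x) → x ≡ y
    le-trans   : ∀ {x y z} → T (le x y) → T (le y z) → T (le x z)

module PosetDefs (P : FinPoset) where
  open FinPoset P public

  Elt : Set
  Elt = Fin n

  _≤_ : Elt → Elt → Set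
  x ≤ y = T (le x y)

  _<_ : Elt → Elt → Set
  x < y = x ≤ y × x ≢ y

  _⋖_ : Elt → Elt → Set
  x ⋖ y = x < y × (∀ z → ¬ (x < z × z < y))

  _≤?_ : ∀ x y → Dec (x ≤ y)
  x ≤? y = Data.Bool.T? (le x y)
    where import Data.Bool

  _<?_ : ∀ x y → Dec (x < y)
  x <? y = (x ≤? y) ×-dec ¬? (x ≟ y)

  _⋖?_ : ∀ x y → Dec (x ⋖ y)
  x ⋖? y = (x <? y) ×-dec all? (λ z → ¬? ((x <? z) ×-dec (z <? y)))

  record Grading : Set where
    field
      rk         : Elt → ℕ
      rk-cover   : ∀ {x y} → x ⋖ y → rk y ≡ suc (rk x)
      rk-minimal : ∀ x → (∀ z → z ≤ x → z ≡ x) → rk x ≡ 0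

  intervalSize : Elt → Elt → ℕ
  intervalSize x y = length (filterᵇ (λ z → le x z ∧ le z y) (allFin n))

  Thin : Grading → Set
  Thin G = ∀ x y → x ≤ y → Grading.rk G y ≡ suc (suc (Grading.rk G x)) →
           intervalSize x y ≡ 4

  record Diamond (x a b y : Elt) : Set where
    field
      xa  : x ⋖ a
      ay  : a ⋖ y
      xb  : x ⋖ b
      by  : b ⋖ y
      a≢b : a ≢ b

  data Chain : Elt → Elt → Set where
    [_]  : ∀ x → Chain x x
    _∷_  : ∀ {x z y} → x ⋖ z → Chain z y → Chain x y

  data Move : ∀ {x y} → Chain x y → Chain x y → Set where
    here  : ∀ {x a b y w} (d : Diamond x a b y) (rest : Chain y w) →
            Move (Diamond.xa d ∷ (Diamond.ay d ∷ rest))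
                 (Diamond.xb d ∷ (Diamond.by d ∷ rest))
    there : ∀ {x z y} (p : x ⋖ z) {c c' : Chain z y} →
            Move c c' → Move (p ∷ c) (p ∷ c')

  DiamondTransitive : Set
  DiamondTransitive = ∀ {x y} (c c' : Chain x y) → Star Move c c'

  -- balanced coloring (values off the cover relations are irrelevant)
  Coloring : Set
  Coloring = Elt → Elt → Sign

  Balanced : Coloring → Set
  Balanced c = ∀ {x a b y} → Diamond x a b y →
               ((c x a *s c a y) *s (c x b *s c b y)) ≡ ⊖s

  BalancedColorable : Set
  BalancedColorable = Σ Coloring Balanced

  UpperIdeal : (Elt → Bool) → Set
  UpperIdeal I = ∀ {x y} → T (I x) → x ≤ y → T (I y)

record Functor {o ℓ e} (P : FinPoset) (𝒜 : Abelian o ℓ e) : Set (o ⊔ ℓ ⊔ e) where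
  open PosetDefs P
  open Abelian 𝒜
  field
    F₀     : Elt → Obj
    F₁     : ∀ {x y} → .(x ≤ y) → Hom (F₀ x) (F₀ y)
    F-id   : ∀ {x} → F₁ (le-refl x) ≈ id
    F-comp : ∀ {x y z} (p : x ≤ y) (q : y ≤ z) → F₁ (le-trans p q) ≈ F₁ q ∘ F₁ p

-- The cochain complex C*(S, 𝒜, F|_S, c|_S) of a subset S of P
-- (S given by its Boolean indicator; ranks are those of P).

module CochainComplex {o ℓ e} (𝒜 : Abelian o ℓ e) (P : FinPoset)
         (G : PosetDefs.Grading P) (F : Functor P 𝒜)
         (c : PosetDefs.Coloring P) where
  open Abelian 𝒜
  open PosetDefs P
  open Functor F
  open Grading G

  ⨁ : List Elt → Obj
  ⨁ []       = 𝟘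
  ⨁ (x ∷ xs) = F₀ x ⊕ ⨁ xs

  inj : (L : List Elt) (i : Fin (length L)) → Hom (F₀ (lookup L i)) (⨁ L)
  inj (x ∷ L) Fin.zero    = ι₁
  inj (x ∷ L) (Fin.suc i) = ι₂ ∘ inj L i

  prj : (L : List Elt) (i : Fin (length L)) → Hom (⨁ L) (F₀ (lookup L i))
  prj (x ∷ L) Fin.zero    = π₁
  prj (x ∷ L) (Fin.suc i) = prj L i ∘ π₂

  matrix : (L M : List Elt) →
           (∀ i j → Hom (F₀ (lookup L i)) (F₀ (lookup M j))) → Hom (⨁ L) (⨁ M)
  matrix L M m = hsum (length L) λ i → hsum (length M) λ j →
                   inj M j ∘ (m i j ∘ prj L i)

  elems : (Elt → Bool) → ℕ → List Elt
  elems S k = filterᵇ (λ x → S x ∧ (rk x ≡ᵇ k)) (allFin n)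

  Cobj : (Elt → Bool) → ℕ → Obj
  Cobj S k = ⨁ (elems S k)

  δ-entry : ∀ x y → Hom (F₀ x) (F₀ y)
  δ-entry x y with x ⋖? y
  ... | yes p = sgn (c x y) (F₁ (proj₁ (proj₁ p)))
  ... | no  _ = 0h

  δ : (S : Elt → Bool) → ∀ k → Hom (Cobj S k) (Cobj S (suc k))
  δ S k = matrix (elems S k) (elems S (suc k)) λ i j →
            δ-entry (lookup (elems S k) i) (lookup (elems S (suc k)) j)

  eq-entry : ∀ x y → Hom (F₀ x) (F₀ y)
  eq-entry x y with x ≟ y
  ... | yes refl = id
  ... | no  _    = 0h

  -- the "identity on common summands" map C^k(S) → C^k(S');
  -- for S ⊆ S' this is the inclusion, for S ⊇ S' the projection
  canon : (S S' : Elt → Bool) → ∀ k → Hom (Cobj S k) (Cobj S' k)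
  canon S S' k = matrix (elems S k) (elems S' k) λ i j →
                   eq-entry (lookup (elems S k) i) (lookup (elems S' k) j)

  Hcoh : (S : Elt → Bool) → ℕ → Set (o ⊔ ℓ ⊔ e)
  Hcoh S k = AbelianDefs.CohomologyAt 𝒜 (Cobj S) (δ S) k

  record LongExactSequence (I : Elt → Bool)
      (hI : ∀ k → Hcoh I k)
      (hP : ∀ k → Hcoh (λ _ → true) k)
      (hQ : ∀ k → Hcoh (λ x → not (I x)) k) : Set (o ⊔ ℓ ⊔ e) where
    open AbelianDefs 𝒜
    private
      HI = λ k → CohomologyAt.H (hI k)
      HP = λ k → CohomologyAt.H (hP k)
      HQ = λ k → CohomologyAt.H (hQ k)
    field
      i : ∀ k → Hom (HI k) (HP k)
      r : ∀ k → Hom (HP k) (HQ k)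
      d : ∀ k → Hom (HQ k) (HI (suc k))
      i-induced : ∀ k → Induced (canon I (λ _ → true) k) (hI k) (hP k) (i k)
      r-induced : ∀ k → Induced (canon (λ _ → true) (λ x → not (I x)) k) (hP k) (hQ k) (r k)
      exact-I₀  : Mono (i 0)
      exact-P   : ∀ k → Exact (i k) (r k)
      exact-Q   : ∀ k → Exact (r k) (d k)
      exact-I   : ∀ k → Exact (d k) (i (suc k))

module Submission where

-- For an upper ideal I of P, with complement P ∖ I, restricting cochains
-- gives maps C*(I) → C*(P) → C*(P ∖ I) which, degree by degree, are the
-- inclusion of and the projection onto complementary direct summands; they
-- commute with the differentials because I is upper and P ∖ I is lower.  So
-- they form a short exact sequence of cochain complexes which splits in
-- each degree, and the theorem is the long exact sequence of such a
-- sequence.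

open import Level using (_⊔_)
open import Data.Nat using (ℕ; zero; suc; _≡ᵇ_)
open import Data.Nat.Properties using (≡ᵇ⇒≡; ≡⇒≡ᵇ)
open import Data.Bool using (Bool; true; false; T; T?; _∧_; not)
open import Data.Bool.Properties using (T-∧; not-involutive)
open import Data.Fin using (Fin; _≟_) renaming (zero to fzero; suc to fsuc)
open import Data.Fin.Properties using (suc-injective)
open import Data.List using (List; []; _∷_; length; lookup; allFin)
open import Data.List.Membership.Propositional using (_∈_; _∉_)
open import Data.List.Membership.Propositional.Properties using (∈-filter⁺; ∈-filter⁻; ∈-allFin; ∈-lookup)
open import Data.List.Relation.Unary.Any using (here; there)
import Data.List.Relation.Unary.All as All
open import Data.List.Relation.Unary.AllPairs using (_∷_)
open import Data.List.Relation.Unary.Unique.Propositional using (Unique)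
import Data.List.Relation.Unary.Unique.Propositional.Properties as Unique
open import Data.Product using (Σ; _×_; _,_; proj₁; proj₂)
open import Data.Sum using (_⊎_; inj₁; inj₂)
open import Data.Unit using (tt)
open import Data.Empty using (⊥; ⊥-elim)
open import Function.Bundles using (Equivalence)
open import Relation.Nullary using (¬_; yes; no)
open import Relation.Binary.PropositionalEquality using (_≡_; _≢_; refl; sym; cong; subst)
open import Algebra.Bundles using (Group)
open import Algebra.Structures using (IsAbelianGroup)
import Algebra.Properties.Group as GroupProperties
open import Relation.Binary.Bundles using (Setoid)
import Relation.Binary.Reasoning.Setoid as SetoidReasoning
open import Defs

module PreadditiveFacts {o ℓ e} (𝒞 : Preadditive o ℓ e) where
  open Preadditive 𝒞
  open PreadditiveDefs 𝒞

  module HomGroup {A B : Obj} = IsAbelianGroup (+-isAbelianGroup {A} {B})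
  open HomGroup public using () renaming
    ( refl to ≈-refl; sym to ≈-sym; trans to ≈-trans
    ; ∙-cong to +-cong; ⁻¹-cong to neg-cong
    ; identityˡ to +-identityˡ; identityʳ to +-identityʳ
    ; inverseʳ to +-inverseʳ; comm to +-comm; assoc to +-assoc )

  homSetoid : Obj → Obj → Setoid ℓ e
  homSetoid A B = record { Carrier = Hom A B ; _≈_ = _≈_
                         ; isEquivalence = HomGroup.isEquivalence }

  homGroup : Obj → Obj → Group ℓ e
  homGroup A B = record { isGroup = HomGroup.isGroup {A} {B} }

  module HomGroupProperties {A B : Obj} = GroupProperties (homGroup A B)
  module ≈-Reasoning {A B : Obj} = SetoidReasoning (homSetoid A B)
  open ≈-Reasoning public using (begin_; _∎; step-≈-⟩; step-≈-⟨)

  infixl 6 _-_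
  _-_ : ∀ {A B} → Hom A B → Hom A B → Hom A B
  f - g = f + (- g)

  ∘-resp-≈ˡ : ∀ {A B C} {f h : Hom B C} {g : Hom A B} → f ≈ h → f ∘ g ≈ h ∘ g
  ∘-resp-≈ˡ p = ∘-resp-≈ p ≈-refl

  ∘-resp-≈ʳ : ∀ {A B C} {f : Hom B C} {g i : Hom A B} → g ≈ i → f ∘ g ≈ f ∘ i
  ∘-resp-≈ʳ p = ∘-resp-≈ ≈-refl p

  sym-assoc : ∀ {A B C D} {f : Hom A B} {g : Hom B C} {h : Hom C D} →
              h ∘ (g ∘ f) ≈ (h ∘ g) ∘ f
  sym-assoc = ≈-sym assoc

  -- by bilinearity f ∘ 0 + f ∘ 0 ≈ f ∘ 0, so f ∘ 0 ≈ 0; similarly 0 ∘ f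
  ∘-zeroʳ : ∀ {A B C} (f : Hom B C) → f ∘ 0h {A} {B} ≈ 0h
  ∘-zeroʳ f = HomGroupProperties.identityˡ-unique _ _
    (≈-trans (≈-sym ∘-distribˡ) (∘-resp-≈ʳ (+-identityˡ 0h)))

  ∘-zeroˡ : ∀ {A B C} (f : Hom A B) → 0h {B} {C} ∘ f ≈ 0h
  ∘-zeroˡ f = HomGroupProperties.identityˡ-unique _ _
    (≈-trans (≈-sym ∘-distribʳ) (∘-resp-≈ˡ (+-identityˡ 0h)))

  ∘-negʳ : ∀ {A B C} (f : Hom B C) (g : Hom A B) → f ∘ (- g) ≈ - (f ∘ g)
  ∘-negʳ f g = HomGroupProperties.inverseˡ-unique _ _
    (≈-trans (≈-sym ∘-distribˡ) (≈-trans (∘-resp-≈ʳ (HomGroup.inverseˡ g)) (∘-zeroʳ f)))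

  ∘-negˡ : ∀ {A B C} (f : Hom B C) (g : Hom A B) → (- f) ∘ g ≈ - (f ∘ g)
  ∘-negˡ f g = HomGroupProperties.inverseˡ-unique _ _
    (≈-trans (≈-sym ∘-distribʳ) (≈-trans (∘-resp-≈ˡ (HomGroup.inverseˡ f)) (∘-zeroˡ g)))

  ∘-distribˡ-sub : ∀ {A B C} {f : Hom B C} {g h : Hom A B} →
                   f ∘ (g - h) ≈ f ∘ g - f ∘ h
  ∘-distribˡ-sub {f = f} {h = h} = ≈-trans ∘-distribˡ (+-cong ≈-refl (∘-negʳ f h))

  ∘-distribʳ-sub : ∀ {A B C} {f : Hom A B} {g h : Hom B C} →
                   (g - h) ∘ f ≈ g ∘ f - h ∘ f
  ∘-distribʳ-sub {f = f} {h = h} = ≈-trans ∘-distribʳ (+-cong ≈-refl (∘-negˡ h f))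

  sub≈0⇒≈ : ∀ {A B} {x y : Hom A B} → x - y ≈ 0h → x ≈ y
  sub≈0⇒≈ = HomGroupProperties.x∙y⁻¹≈ε⇒x≈y _ _

  ≈⇒sub≈0 : ∀ {A B} {x y : Hom A B} → x ≈ y → x - y ≈ 0h
  ≈⇒sub≈0 = HomGroupProperties.x≈y⇒x∙y⁻¹≈ε

  sub-zero : ∀ {A B} (x : Hom A B) → x - 0h ≈ x
  sub-zero x = ≈-trans (+-cong ≈-refl HomGroupProperties.ε⁻¹≈ε) (+-identityʳ x)

  neg-involutive : ∀ {A B} (x : Hom A B) → - (- x) ≈ x
  neg-involutive = HomGroupProperties.⁻¹-involutive

  +≈⇒≈sub : ∀ {A B} {a b c : Hom A B} → a + b ≈ c → a ≈ c - b
  +≈⇒≈sub = HomGroupProperties.x≈z//y _ _ _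

  mono-by-zero : ∀ {A B} {f : Hom A B} →
    (∀ {X} (g : Hom X A) → f ∘ g ≈ 0h → g ≈ 0h) → Mono f
  mono-by-zero z g h p = sub≈0⇒≈ (z (g - h) (≈-trans ∘-distribˡ-sub (≈⇒sub≈0 p)))

  epi-by-zero : ∀ {A B} {f : Hom A B} →
    (∀ {X} (g : Hom B X) → g ∘ f ≈ 0h → g ≈ 0h) → Epi f
  epi-by-zero z g h p = sub≈0⇒≈ (z (g - h) (≈-trans ∘-distribʳ-sub (≈⇒sub≈0 p)))

  mono-zero : ∀ {A B X} {f : Hom A B} → Mono f → (g : Hom X A) → f ∘ g ≈ 0h → g ≈ 0h
  mono-zero {f = f} m g p = m g 0h (≈-trans p (≈-sym (∘-zeroʳ f)))

  epi-zero : ∀ {A B X} {f : Hom A B} → Epi f → (g : Hom B X) → g ∘ f ≈ 0h → g ≈ 0h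
  epi-zero {f = f} m g p = m g 0h (≈-trans p (≈-sym (∘-zeroˡ f)))

  split-mono : ∀ {A B} {f : Hom A B} {r : Hom B A} → r ∘ f ≈ id → Mono f
  split-mono {f = f} {r} p g h q = begin
    g            ≈⟨ identityˡ ⟨
    id ∘ g       ≈⟨ ∘-resp-≈ˡ p ⟨
    (r ∘ f) ∘ g  ≈⟨ assoc ⟩
    r ∘ (f ∘ g)  ≈⟨ ∘-resp-≈ʳ q ⟩
    r ∘ (f ∘ h)  ≈⟨ sym-assoc ⟩
    (r ∘ f) ∘ h  ≈⟨ ∘-resp-≈ˡ p ⟩
    id ∘ h       ≈⟨ identityˡ ⟩
    h            ∎

  mono-∘ : ∀ {A B C} {f : Hom B C} {g : Hom A B} → Mono f → Mono g → Mono (f ∘ g)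
  mono-∘ mf mg a b p = mg a b (mf _ _ (≈-trans sym-assoc (≈-trans p assoc)))

  epi-∘ : ∀ {A B C} {f : Hom B C} {g : Hom A B} → Epi f → Epi g → Epi (f ∘ g)
  epi-∘ ef eg a b p = ef a b (eg _ _ (≈-trans assoc (≈-trans p sym-assoc)))

  -- by uniqueness in the universal property, kernels are mono and
  -- cokernels are epi
  kernel-mono : ∀ {A B K} {f : Hom A B} {k : Hom K A} → IsKernel f k → Mono k
  kernel-mono {f = f} {k} isK g h kg≈kh =
    let (_ , _ , unique) = IsKernel.universal isK (k ∘ g) f∘k∘g
    in ≈-trans (unique g ≈-refl) (≈-sym (unique h (≈-sym kg≈kh)))
    where
    f∘k∘g : f ∘ (k ∘ g) ≈ 0h
    f∘k∘g = ≈-trans sym-assoc (≈-trans (∘-resp-≈ˡ (IsKernel.comm isK)) (∘-zeroˡ g))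

  cokernel-epi : ∀ {A B Q} {f : Hom A B} {q : Hom B Q} → IsCokernel f q → Epi q
  cokernel-epi {f = f} {q} isC g h gq≈hq =
    let (_ , _ , unique) = IsCokernel.universal isC (g ∘ q) g∘q∘f
    in ≈-trans (unique g ≈-refl) (≈-sym (unique h (≈-sym gq≈hq)))
    where
    g∘q∘f : (g ∘ q) ∘ f ≈ 0h
    g∘q∘f = ≈-trans assoc (≈-trans (∘-resp-≈ʳ (IsCokernel.comm isC)) (∘-zeroʳ g))

  hsum-cong : ∀ {A B} m {f g : Fin m → Hom A B} → (∀ i → f i ≈ g i) → hsum m f ≈ hsum m g
  hsum-cong zero    p = ≈-refl
  hsum-cong (suc m) p = +-cong (p fzero) (hsum-cong m (λ i → p (fsuc i)))

  hsum-zero : ∀ {A B} m {f : Fin m → Hom A B} → (∀ i → f i ≈ 0h) → hsum m f ≈ 0h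
  hsum-zero zero    p = ≈-refl
  hsum-zero (suc m) p =
    ≈-trans (+-cong (p fzero) (hsum-zero m (λ i → p (fsuc i)))) (+-identityˡ 0h)

  hsum-∘ˡ : ∀ {A B C} m (f : Fin m → Hom B C) (g : Hom A B) →
            hsum m f ∘ g ≈ hsum m (λ i → f i ∘ g)
  hsum-∘ˡ zero    f g = ∘-zeroˡ g
  hsum-∘ˡ (suc m) f g = ≈-trans ∘-distribʳ (+-cong ≈-refl (hsum-∘ˡ m (λ i → f (fsuc i)) g))

  hsum-∘ʳ : ∀ {A B C} m (f : Fin m → Hom A B) (g : Hom B C) →
            g ∘ hsum m f ≈ hsum m (λ i → g ∘ f i)
  hsum-∘ʳ zero    f g = ∘-zeroʳ g
  hsum-∘ʳ (suc m) f g = ≈-trans ∘-distribˡ (+-cong ≈-refl (hsum-∘ʳ m (λ i → f (fsuc i)) g))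

  hsum-single : ∀ {A B} m (k : Fin m) (f : Fin m → Hom A B) →
                (∀ i → i ≢ k → f i ≈ 0h) → hsum m f ≈ f k
  hsum-single (suc m) fzero f p =
    ≈-trans (+-cong ≈-refl (hsum-zero m (λ i → p (fsuc i) (λ ())))) (+-identityʳ _)
  hsum-single (suc m) (fsuc k) f p =
    ≈-trans (+-cong (p fzero (λ ()))
                    (hsum-single m k (λ i → f (fsuc i)) (λ i i≢k → p (fsuc i) (λ q → i≢k (suc-injective q)))))
            (+-identityˡ _)

-- Diagram chasing in an abelian category with "elements up to an epimorphic
-- cover": a generalized element x : X → B lifts along f : A → B if, after
-- precomposing with some epimorphism onto X, it factors through f.
module AbelianChase {o ℓ e} (𝒜 : Abelian o ℓ e) where
  open Abelian 𝒜
  open PreadditiveFacts preadditive public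
  open AbelianDefs 𝒜 public

  from𝟘 : ∀ {A} (f g : Hom 𝟘 A) → f ≈ g
  from𝟘 f g = ≈-trans (𝟘-initial f) (≈-sym (𝟘-initial g))

  record Lift {A B X} (f : Hom A B) (x : Hom X B) : Set (o ⊔ ℓ ⊔ e) where
    field
      Cover     : Obj
      cover     : Hom Cover X
      cover-epi : Epi cover
      lift      : Hom Cover A
      lifts     : f ∘ lift ≈ x ∘ cover

  -- an epimorphism is the cokernel of its kernel
  epi-cokernel-of-kernel : ∀ {A B K Y} {m : Hom A B} {k : Hom K A} → Epi m →
    IsKernel m k → (φ : Hom A Y) → φ ∘ k ≈ 0h → Σ (Hom B Y) λ h → h ∘ m ≈ φ
  epi-cokernel-of-kernel {m = m} {k} m-epi isK φ φk =
    let (_ , g , isC) = epi-normal m m-epi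
        (u , ku≈g , _) = IsKernel.universal isK g (IsCokernel.comm isC)
        φg : φ ∘ g ≈ 0h
        φg = begin
          φ ∘ g        ≈⟨ ∘-resp-≈ʳ ku≈g ⟨
          φ ∘ (k ∘ u)  ≈⟨ sym-assoc ⟩
          (φ ∘ k) ∘ u  ≈⟨ ∘-resp-≈ˡ φk ⟩
          0h ∘ u       ≈⟨ ∘-zeroˡ u ⟩
          0h           ∎
        (h , hm≈φ , _) = IsCokernel.universal isC φ φg
    in h , hm≈φ

  -- dually, a monomorphism is the kernel of its cokernel
  mono-kernel-of-cokernel : ∀ {A B Q Y} {n : Hom A B} {q : Hom B Q} → Mono n →
    IsCokernel n q → (ψ : Hom Y B) → q ∘ ψ ≈ 0h → Σ (Hom Y A) λ v → n ∘ v ≈ ψ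
  mono-kernel-of-cokernel {n = n} {q} n-mono isC ψ qψ =
    let (_ , c , isK) = mono-normal n n-mono
        (c' , c'q≈c , _) = IsCokernel.universal isC c (IsKernel.comm isK)
        cψ : c ∘ ψ ≈ 0h
        cψ = begin
          c ∘ ψ         ≈⟨ ∘-resp-≈ˡ c'q≈c ⟨
          (c' ∘ q) ∘ ψ  ≈⟨ assoc ⟩
          c' ∘ (q ∘ ψ)  ≈⟨ ∘-resp-≈ʳ qψ ⟩
          c' ∘ 0h       ≈⟨ ∘-zeroʳ c' ⟩
          0h            ∎
        (v , nv≈ψ , _) = IsKernel.universal isK ψ cψ
    in v , nv≈ψ

  -- Every generalized element lifts along an epimorphism p : Z → H; the
  -- cover is the pullback of p and x, built as the kernel of [p , -x].
  lift-along-epi : ∀ {Z H X} {p : Hom Z H} → Epi p → (x : Hom X H) → Lift p x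
  lift-along-epi {Z} {H} {X} {p} p-epi x = record
    { Cover = Kernel.Ker ker-m ; cover = π₂ ∘ k ; cover-epi = cover-epi
    ; lift = π₁ ∘ k ; lifts = sub≈0⇒≈ square }
    where
    m : Hom (Z ⊕ X) H
    m = p ∘ π₁ - x ∘ π₂
    ker-m : Kernel m
    ker-m = kernel m
    k : Hom (Kernel.Ker ker-m) (Z ⊕ X)
    k = Kernel.arrow ker-m
    isK : IsKernel m k
    isK = Kernel.isKernel ker-m

    square : p ∘ (π₁ ∘ k) - x ∘ (π₂ ∘ k) ≈ 0h
    square = begin
      p ∘ (π₁ ∘ k) - x ∘ (π₂ ∘ k)  ≈⟨ +-cong sym-assoc (neg-cong sym-assoc) ⟩
      (p ∘ π₁) ∘ k - (x ∘ π₂) ∘ k  ≈⟨ ∘-distribʳ-sub ⟨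
      m ∘ k                        ≈⟨ IsKernel.comm isK ⟩
      0h                           ∎

    m∘ι₁ : m ∘ ι₁ ≈ p
    m∘ι₁ = begin
      (p ∘ π₁ - x ∘ π₂) ∘ ι₁         ≈⟨ ∘-distribʳ-sub ⟩
      (p ∘ π₁) ∘ ι₁ - (x ∘ π₂) ∘ ι₁  ≈⟨ +-cong assoc (neg-cong assoc) ⟩
      p ∘ (π₁ ∘ ι₁) - x ∘ (π₂ ∘ ι₁)  ≈⟨ +-cong (∘-resp-≈ʳ π₁ι₁) (neg-cong (∘-resp-≈ʳ π₂ι₁)) ⟩
      p ∘ id - x ∘ 0h                ≈⟨ +-cong identityʳ (neg-cong (∘-zeroʳ x)) ⟩
      p - 0h                         ≈⟨ sub-zero p ⟩
      p                              ∎

    m-epi : Epi m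
    m-epi = epi-by-zero λ g gm → epi-zero p-epi g (begin
      g ∘ p         ≈⟨ ∘-resp-≈ʳ m∘ι₁ ⟨
      g ∘ (m ∘ ι₁)  ≈⟨ sym-assoc ⟩
      (g ∘ m) ∘ ι₁  ≈⟨ ∘-resp-≈ˡ gm ⟩
      0h ∘ ι₁       ≈⟨ ∘-zeroˡ ι₁ ⟩
      0h            ∎)

    -- g ∘ π₂ kills k, so it factors through m as h; h kills p, hence g ∘ π₂ ≈ 0
    cover-epi : Epi (π₂ ∘ k)
    cover-epi = epi-by-zero λ g gπ₂k →
      let (h , hm≈gπ₂) = epi-cokernel-of-kernel m-epi isK (g ∘ π₂) (≈-trans assoc gπ₂k)
          h≈0 : h ≈ 0h
          h≈0 = epi-zero p-epi h (begin
            h ∘ p          ≈⟨ ∘-resp-≈ʳ m∘ι₁ ⟨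
            h ∘ (m ∘ ι₁)   ≈⟨ sym-assoc ⟩
            (h ∘ m) ∘ ι₁   ≈⟨ ∘-resp-≈ˡ hm≈gπ₂ ⟩
            (g ∘ π₂) ∘ ι₁  ≈⟨ assoc ⟩
            g ∘ (π₂ ∘ ι₁)  ≈⟨ ∘-resp-≈ʳ π₂ι₁ ⟩
            g ∘ 0h         ≈⟨ ∘-zeroʳ g ⟩
            0h             ∎)
      in begin
        g              ≈⟨ identityʳ ⟨
        g ∘ id         ≈⟨ ∘-resp-≈ʳ π₂ι₂ ⟨
        g ∘ (π₂ ∘ ι₂)  ≈⟨ sym-assoc ⟩
        (g ∘ π₂) ∘ ι₂  ≈⟨ ∘-resp-≈ˡ hm≈gπ₂ ⟨
        (h ∘ m) ∘ ι₂   ≈⟨ ∘-resp-≈ˡ (∘-resp-≈ˡ h≈0) ⟩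
        (0h ∘ m) ∘ ι₂  ≈⟨ ≈-trans (∘-resp-≈ˡ (∘-zeroˡ m)) (∘-zeroˡ ι₂) ⟩
        0h             ∎

  -- If p is a cokernel of u : C → Z, then u factors through the kernel m of
  -- p by an epimorphism (the image of u is the kernel of its cokernel).
  module CokernelFactorisation {C Z H} {u : Hom C Z} {p : Hom Z H} (isC : IsCokernel u p) where
    K : Obj
    K = Kernel.Ker (kernel p)

    m : Hom K Z
    m = Kernel.arrow (kernel p)

    m-ker : IsKernel p m
    m-ker = Kernel.isKernel (kernel p)

    factor : Hom C K
    factor = proj₁ (IsKernel.universal m-ker u (IsCokernel.comm isC))

    m∘factor : m ∘ factor ≈ u
    m∘factor = proj₁ (proj₂ (IsKernel.universal m-ker u (IsCokernel.comm isC)))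

    -- if g ∘ factor ≈ 0 then factor lands in the kernel j of g; the cokernel
    -- q of the mono m ∘ j kills u, hence factors through p, hence kills m;
    -- so m factors through m ∘ j, j is split epi and g ≈ 0
    factor-cancels-zero : ∀ {T} (g : Hom K T) → g ∘ factor ≈ 0h → g ≈ 0h
    factor-cancels-zero g g∘factor≈0 = begin
      g            ≈⟨ identityʳ ⟨
      g ∘ id       ≈⟨ ∘-resp-≈ʳ j∘w≈id ⟨
      g ∘ (j ∘ w)  ≈⟨ sym-assoc ⟩
      (g ∘ j) ∘ w  ≈⟨ ∘-resp-≈ˡ (IsKernel.comm j-ker) ⟩
      0h ∘ w       ≈⟨ ∘-zeroˡ w ⟩
      0h           ∎
      where
      j : Hom (Kernel.Ker (kernel g)) K
      j = Kernel.arrow (kernel g)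

      j-ker : IsKernel g j
      j-ker = Kernel.isKernel (kernel g)

      q : Hom Z (Cokernel.Coker (cokernel (m ∘ j)))
      q = Cokernel.arrow (cokernel (m ∘ j))

      q-cok : IsCokernel (m ∘ j) q
      q-cok = Cokernel.isCokernel (cokernel (m ∘ j))

      q∘u : q ∘ u ≈ 0h
      q∘u =
        let (f' , jf'≈factor , _) = IsKernel.universal j-ker factor g∘factor≈0
        in begin
          q ∘ u               ≈⟨ ∘-resp-≈ʳ (≈-trans (∘-resp-≈ʳ jf'≈factor) m∘factor) ⟨
          q ∘ (m ∘ (j ∘ f'))  ≈⟨ ∘-resp-≈ʳ sym-assoc ⟩
          q ∘ ((m ∘ j) ∘ f')  ≈⟨ sym-assoc ⟩
          (q ∘ (m ∘ j)) ∘ f'  ≈⟨ ∘-resp-≈ˡ (IsCokernel.comm q-cok) ⟩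
          0h ∘ f'             ≈⟨ ∘-zeroˡ f' ⟩
          0h                  ∎

      q∘m : q ∘ m ≈ 0h
      q∘m =
        let (q' , q'p≈q , _) = IsCokernel.universal isC q q∘u
        in begin
          q ∘ m         ≈⟨ ∘-resp-≈ˡ q'p≈q ⟨
          (q' ∘ p) ∘ m  ≈⟨ assoc ⟩
          q' ∘ (p ∘ m)  ≈⟨ ∘-resp-≈ʳ (IsKernel.comm m-ker) ⟩
          q' ∘ 0h       ≈⟨ ∘-zeroʳ q' ⟩
          0h            ∎

      m-through-m∘j : Σ (Hom K (Kernel.Ker (kernel g))) λ w → (m ∘ j) ∘ w ≈ m
      m-through-m∘j = mono-kernel-of-cokernel
        (mono-∘ (kernel-mono m-ker) (kernel-mono j-ker)) q-cok m q∘m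

      w : Hom K (Kernel.Ker (kernel g))
      w = proj₁ m-through-m∘j

      j∘w≈id : j ∘ w ≈ id
      j∘w≈id = kernel-mono m-ker (j ∘ w) id
        (≈-trans sym-assoc (≈-trans (proj₂ m-through-m∘j) (≈-sym identityʳ)))

    factor-epi : Epi factor
    factor-epi = epi-by-zero factor-cancels-zero

  -- If p is a cokernel of u, everything killed by p lifts along u: it factors
  -- through the kernel of p, and then lifts along the epimorphism factor.
  lift-along-cokernel : ∀ {C Z H X} {u : Hom C Z} {p : Hom Z H} → IsCokernel u p →
                        (a : Hom X Z) → p ∘ a ≈ 0h → Lift u a
  lift-along-cokernel {X = X} {u = u} isC a p∘a≈0 = record
    { Cover = Cover ; cover = cover ; cover-epi = cover-epi ; lift = lift
    ; lifts = begin
        u ∘ lift             ≈⟨ ∘-resp-≈ˡ m∘factor ⟨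
        (m ∘ factor) ∘ lift  ≈⟨ assoc ⟩
        m ∘ (factor ∘ lift)  ≈⟨ ∘-resp-≈ʳ lifts ⟩
        m ∘ (a' ∘ cover)     ≈⟨ sym-assoc ⟩
        (m ∘ a') ∘ cover     ≈⟨ ∘-resp-≈ˡ (proj₂ a-through-m) ⟩
        a ∘ cover            ∎ }
    where
    open CokernelFactorisation isC
    a-through-m : Σ (Hom X K) λ a' → m ∘ a' ≈ a
    a-through-m = let (a' , ma'≈a , _) = IsKernel.universal m-ker a p∘a≈0 in a' , ma'≈a
    a' : Hom X K
    a' = proj₁ a-through-m
    open Lift (lift-along-epi factor-epi a')

  -- f then g is exact if g ∘ f ≈ 0 and everything killed by g lifts along f:
  -- then im f ⊆ ker g because g factors through the cokernel of f, and
  -- ker g ⊆ im f because the cokernel of f kills the lifted kernel of g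
  exact-by-lifting : ∀ {A B C} {f : Hom A B} {g : Hom B C} → g ∘ f ≈ 0h →
    (∀ {X} (x : Hom X B) → g ∘ x ≈ 0h → Lift f x) → Exact f g
  exact-by-lifting {B = B} {f = f} {g} g∘f≈0 lifting =
    let (u , k∘u≈im , _) = IsKernel.universal k-ker (im f) g∘im
        (v , im∘v≈k , _) = IsKernel.universal (Kernel.isKernel (kernel q)) k q∘k
    in u , v , k∘u≈im , im∘v≈k
    where
    k : Hom (Kernel.Ker (kernel g)) B
    k = Kernel.arrow (kernel g)

    k-ker : IsKernel g k
    k-ker = Kernel.isKernel (kernel g)

    q : Hom B (Cokernel.Coker (cokernel f))
    q = Cokernel.arrow (cokernel f)

    q-cok : IsCokernel f q
    q-cok = Cokernel.isCokernel (cokernel f)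

    g∘im : g ∘ im f ≈ 0h
    g∘im =
      let (g' , g'q≈g , _) = IsCokernel.universal q-cok g g∘f≈0
      in begin
        g ∘ im f         ≈⟨ ∘-resp-≈ˡ g'q≈g ⟨
        (g' ∘ q) ∘ im f  ≈⟨ assoc ⟩
        g' ∘ (q ∘ im f)  ≈⟨ ∘-resp-≈ʳ (IsKernel.comm (Kernel.isKernel (kernel q))) ⟩
        g' ∘ 0h          ≈⟨ ∘-zeroʳ g' ⟩
        0h               ∎

    q∘k : q ∘ k ≈ 0h
    q∘k = epi-zero cover-epi (q ∘ k) (begin
      (q ∘ k) ∘ cover  ≈⟨ assoc ⟩
      q ∘ (k ∘ cover)  ≈⟨ ∘-resp-≈ʳ lifts ⟨
      q ∘ (f ∘ lift)   ≈⟨ sym-assoc ⟩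
      (q ∘ f) ∘ lift   ≈⟨ ∘-resp-≈ˡ (IsCokernel.comm q-cok) ⟩
      0h ∘ lift        ≈⟨ ∘-zeroˡ lift ⟩
      0h               ∎)
      where open Lift (lifting k (IsKernel.comm k-ker))

module Cohomology {o ℓ e} (𝒜 : Abelian o ℓ e) where
  open Abelian 𝒜
  open AbelianChase 𝒜

  module CohomologyFacts {C : ℕ → Obj} {δ : ∀ k → Hom (C k) (C (suc k))} {k}
                         (h : CohomologyAt C δ k) where
    open CohomologyAt h public

    δ∘z : δ k ∘ z ≈ 0h
    δ∘z = IsKernel.comm z-ker

    p∘u : p ∘ u ≈ 0h
    p∘u = IsCokernel.comm p-cok

    z-mono : Mono z
    z-mono = kernel-mono z-ker

    p-epi : Epi p
    p-epi = cokernel-epi p-cok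

    δ∘z∘ : ∀ {X} (y : Hom X Z) → δ k ∘ (z ∘ y) ≈ 0h
    δ∘z∘ y = ≈-trans sym-assoc (≈-trans (∘-resp-≈ˡ δ∘z) (∘-zeroˡ y))

    as-cocycle : ∀ {X} (a : Hom X (C k)) → δ k ∘ a ≈ 0h → Σ (Hom X Z) λ a' → z ∘ a' ≈ a
    as-cocycle a δa = let (a' , za' , _) = IsKernel.universal z-ker a δa in a' , za'

    δ∘δin : δ k ∘ δin C δ k ≈ 0h
    δ∘δin = begin
      δ k ∘ δin C δ k  ≈⟨ ∘-resp-≈ʳ u-fac ⟨
      δ k ∘ (z ∘ u)    ≈⟨ sym-assoc ⟩
      (δ k ∘ z) ∘ u    ≈⟨ ∘-resp-≈ˡ δ∘z ⟩
      0h ∘ u           ≈⟨ ∘-zeroˡ u ⟩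
      0h               ∎

    z-shift : ∀ {X} (y : Hom X Z) (c : Hom X (Cin C δ k)) →
              z ∘ (y - u ∘ c) ≈ z ∘ y - δin C δ k ∘ c
    z-shift y c = ≈-trans ∘-distribˡ-sub
      (+-cong ≈-refl (neg-cong (≈-trans sym-assoc (∘-resp-≈ˡ u-fac))))

    p-shift : ∀ {X} (y : Hom X Z) (c : Hom X (Cin C δ k)) → p ∘ (y - u ∘ c) ≈ p ∘ y
    p-shift y c = begin
      p ∘ (y - u ∘ c)      ≈⟨ ∘-distribˡ-sub ⟩
      p ∘ y - p ∘ (u ∘ c)  ≈⟨ +-cong ≈-refl (neg-cong (≈-trans sym-assoc (∘-resp-≈ˡ p∘u))) ⟩
      p ∘ y - 0h ∘ c       ≈⟨ +-cong ≈-refl (neg-cong (∘-zeroˡ c)) ⟩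
      p ∘ y - 0h           ≈⟨ sub-zero _ ⟩
      p ∘ y                ∎

  open CohomologyFacts

  module _ {C D : ℕ → Obj} {δC : ∀ k → Hom (C k) (C (suc k))}
           {δD : ∀ k → Hom (D k) (D (suc k))} where

    record CohomologyMap {k l} (hC : CohomologyAt C δC k) (hD : CohomologyAt D δD l)
                         (g : Hom (C k) (D l)) : Set (ℓ ⊔ e) where
      field
        onCocycles      : Hom (Z hC) (Z hD)
        onCocycles-comm : z hD ∘ onCocycles ≈ g ∘ z hC
        map           : Hom (H hC) (H hD)
        map-comm      : map ∘ p hC ≈ p hD ∘ onCocycles

    is-induced : ∀ {k} {hC : CohomologyAt C δC k} {hD : CohomologyAt D δD k} {f} →
                 (φ : CohomologyMap hC hD f) → Induced f hC hD (CohomologyMap.map φ)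
    is-induced φ = onCocycles , onCocycles-comm , map-comm
      where open CohomologyMap φ

    descend : ∀ {k l} (hC : CohomologyAt C δC k) (hD : CohomologyAt D δD l)
              (g : Hom (C k) (D l)) → δD l ∘ (g ∘ z hC) ≈ 0h →
              (b : Hom (Cin C δC k) (Cin D δD l)) → g ∘ δin C δC k ≈ δin D δD l ∘ b →
              CohomologyMap hC hD g
    descend {k} {l} hC hD g g-cocycles b g-boundaries = record
      { onCocycles = w ; onCocycles-comm = zD∘w
      ; map = proj₁ descended ; map-comm = proj₂ descended }
      where
      w : Hom (Z hC) (Z hD)
      w = proj₁ (as-cocycle hD (g ∘ z hC) g-cocycles)
      zD∘w : z hD ∘ w ≈ g ∘ z hC
      zD∘w = proj₂ (as-cocycle hD (g ∘ z hC) g-cocycles)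
      w∘u : w ∘ u hC ≈ u hD ∘ b
      w∘u = z-mono hD _ _ (begin
        z hD ∘ (w ∘ u hC)  ≈⟨ sym-assoc ⟩
        (z hD ∘ w) ∘ u hC  ≈⟨ ∘-resp-≈ˡ zD∘w ⟩
        (g ∘ z hC) ∘ u hC  ≈⟨ assoc ⟩
        g ∘ (z hC ∘ u hC)  ≈⟨ ∘-resp-≈ʳ (u-fac hC) ⟩
        g ∘ δin C δC k     ≈⟨ g-boundaries ⟩
        δin D δD l ∘ b     ≈⟨ ∘-resp-≈ˡ (u-fac hD) ⟨
        (z hD ∘ u hD) ∘ b  ≈⟨ assoc ⟩
        z hD ∘ (u hD ∘ b)  ∎)
      pw∘u : (p hD ∘ w) ∘ u hC ≈ 0h
      pw∘u = begin
        (p hD ∘ w) ∘ u hC  ≈⟨ assoc ⟩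
        p hD ∘ (w ∘ u hC)  ≈⟨ ∘-resp-≈ʳ w∘u ⟩
        p hD ∘ (u hD ∘ b)  ≈⟨ sym-assoc ⟩
        (p hD ∘ u hD) ∘ b  ≈⟨ ∘-resp-≈ˡ (p∘u hD) ⟩
        0h ∘ b             ≈⟨ ∘-zeroˡ b ⟩
        0h                 ∎
      descended : Σ (Hom (H hC) (H hD)) λ m → m ∘ p hC ≈ p hD ∘ w
      descended = let (m , m∘p≈p∘w , _) = IsCokernel.universal (p-cok hC) (p hD ∘ w) pw∘u
                  in m , m∘p≈p∘w

    shifted : (∀ k → Hom (C k) (D k)) → ∀ k → Hom (Cin C δC k) (Cin D δD k)
    shifted f zero    = 0h
    shifted f (suc k) = f k

    induced : (f : ∀ k → Hom (C k) (D k)) → (∀ k → δD k ∘ f k ≈ f (suc k) ∘ δC k) →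
              ∀ {k} (hC : CohomologyAt C δC k) (hD : CohomologyAt D δD k) →
              CohomologyMap hC hD (f k)
    induced f f-chain {k} hC hD = descend hC hD (f k) f-cocycles (shifted f k) (f-boundaries k)
      where
      f-cocycles : δD k ∘ (f k ∘ z hC) ≈ 0h
      f-cocycles = begin
        δD k ∘ (f k ∘ z hC)        ≈⟨ sym-assoc ⟩
        (δD k ∘ f k) ∘ z hC        ≈⟨ ∘-resp-≈ˡ (f-chain k) ⟩
        (f (suc k) ∘ δC k) ∘ z hC  ≈⟨ assoc ⟩
        f (suc k) ∘ (δC k ∘ z hC)  ≈⟨ ∘-resp-≈ʳ (δ∘z hC) ⟩
        f (suc k) ∘ 0h             ≈⟨ ∘-zeroʳ _ ⟩
        0h                         ∎
      f-boundaries : ∀ k → f k ∘ δin C δC k ≈ δin D δD k ∘ shifted f k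
      f-boundaries zero    = from𝟘 _ _
      f-boundaries (suc k) = ≈-sym (f-chain k)

  module _ {C D : ℕ → Obj} {δC : ∀ k → Hom (C k) (C (suc k))}
           {δD : ∀ k → Hom (D k) (D (suc k))} {k l}
           {hC : CohomologyAt C δC k} {hD : CohomologyAt D δD l}
           {g : Hom (C k) (D l)} (φ : CohomologyMap hC hD g) where
    open CohomologyMap φ

    -- First half of a chase: a class killed by φ is represented (after an
    -- epimorphic cover) by a cocycle whose image under g is a coboundary.
    record KernelChase {X} (x : Hom X (H hC)) : Set (o ⊔ ℓ ⊔ e) where
      field
        Cover      : Obj
        cover      : Hom Cover X
        cover-epi  : Epi cover
        cocycle    : Hom Cover (Z hC)
        represents : p hC ∘ cocycle ≈ x ∘ cover
        witness    : Hom Cover (Cin D δD l)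
        bounds     : g ∘ (z hC ∘ cocycle) ≈ δin D δD l ∘ witness

    kernel-chase : ∀ {X} (x : Hom X (H hC)) → map ∘ x ≈ 0h → KernelChase x
    kernel-chase x φx≈0 = record
      { Cover = L₂.Cover ; cover = L₁.cover ∘ L₂.cover
      ; cover-epi = epi-∘ L₁.cover-epi L₂.cover-epi
      ; cocycle = L₁.lift ∘ L₂.cover
      ; represents = begin
          p hC ∘ (L₁.lift ∘ L₂.cover)  ≈⟨ sym-assoc ⟩
          (p hC ∘ L₁.lift) ∘ L₂.cover  ≈⟨ ∘-resp-≈ˡ L₁.lifts ⟩
          (x ∘ L₁.cover) ∘ L₂.cover    ≈⟨ assoc ⟩
          x ∘ (L₁.cover ∘ L₂.cover)    ∎
      ; witness = L₂.lift
      ; bounds = begin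
          g ∘ (z hC ∘ (L₁.lift ∘ L₂.cover))           ≈⟨ sym-assoc ⟩
          (g ∘ z hC) ∘ (L₁.lift ∘ L₂.cover)           ≈⟨ ∘-resp-≈ˡ onCocycles-comm ⟨
          (z hD ∘ onCocycles) ∘ (L₁.lift ∘ L₂.cover)  ≈⟨ ≈-trans assoc (∘-resp-≈ʳ sym-assoc) ⟩
          z hD ∘ ((onCocycles ∘ L₁.lift) ∘ L₂.cover)  ≈⟨ ∘-resp-≈ʳ L₂.lifts ⟨
          z hD ∘ (u hD ∘ L₂.lift)                     ≈⟨ sym-assoc ⟩
          (z hD ∘ u hD) ∘ L₂.lift                     ≈⟨ ∘-resp-≈ˡ (u-fac hD) ⟩
          δin D δD l ∘ L₂.lift                        ∎ }
      where
      -- represent x by a cocycle, whose image under φ then has class zero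
      module L₁ = Lift (lift-along-epi (p-epi hC) x)
      killed : p hD ∘ (onCocycles ∘ L₁.lift) ≈ 0h
      killed = begin
        p hD ∘ (onCocycles ∘ L₁.lift)  ≈⟨ sym-assoc ⟩
        (p hD ∘ onCocycles) ∘ L₁.lift  ≈⟨ ∘-resp-≈ˡ map-comm ⟨
        (map ∘ p hC) ∘ L₁.lift         ≈⟨ assoc ⟩
        map ∘ (p hC ∘ L₁.lift)         ≈⟨ ∘-resp-≈ʳ L₁.lifts ⟩
        map ∘ (x ∘ L₁.cover)           ≈⟨ sym-assoc ⟩
        (map ∘ x) ∘ L₁.cover           ≈⟨ ∘-resp-≈ˡ φx≈0 ⟩
        0h ∘ L₁.cover                  ≈⟨ ∘-zeroˡ _ ⟩
        0h                             ∎
      -- so that image is a boundary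
      module L₂ = Lift (lift-along-cokernel (p-cok hD) (onCocycles ∘ L₁.lift) killed)

    -- Second half of a chase: a class represented by a cocycle y which is
    -- the image under g of a cochain α killed by δ lies in the image of φ.
    lift-by-cocycle : ∀ {X Y} {x : Hom X (H hD)} {cover : Hom Y X} → Epi cover →
      (y : Hom Y (Z hD)) → p hD ∘ y ≈ x ∘ cover →
      (α : Hom Y (C k)) → δC k ∘ α ≈ 0h → g ∘ α ≈ z hD ∘ y → Lift map x
    lift-by-cocycle {Y = Y} {x} {cover} cover-epi y represents α α-cocycle gα≈y = record
      { Cover = Y ; cover = cover ; cover-epi = cover-epi ; lift = p hC ∘ a
      ; lifts = begin
          map ∘ (p hC ∘ a)         ≈⟨ sym-assoc ⟩
          (map ∘ p hC) ∘ a         ≈⟨ ∘-resp-≈ˡ map-comm ⟩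
          (p hD ∘ onCocycles) ∘ a  ≈⟨ assoc ⟩
          p hD ∘ (onCocycles ∘ a)  ≈⟨ ∘-resp-≈ʳ w∘a≈y ⟩
          p hD ∘ y                 ≈⟨ represents ⟩
          x ∘ cover                ∎ }
      where
      a : Hom Y (Z hC)
      a = proj₁ (as-cocycle hC α α-cocycle)
      za≈α : z hC ∘ a ≈ α
      za≈α = proj₂ (as-cocycle hC α α-cocycle)
      w∘a≈y : onCocycles ∘ a ≈ y
      w∘a≈y = z-mono hD _ _ (begin
        z hD ∘ (onCocycles ∘ a)  ≈⟨ sym-assoc ⟩
        (z hD ∘ onCocycles) ∘ a  ≈⟨ ∘-resp-≈ˡ onCocycles-comm ⟩
        (g ∘ z hC) ∘ a           ≈⟨ assoc ⟩
        g ∘ (z hC ∘ a)           ≈⟨ ∘-resp-≈ʳ za≈α ⟩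
        g ∘ α                    ≈⟨ gα≈y ⟩
        z hD ∘ y                 ∎)

  composite-vanishes :
    ∀ {C D E : ℕ → Obj} {δC : ∀ k → Hom (C k) (C (suc k))}
      {δD : ∀ k → Hom (D k) (D (suc k))} {δE : ∀ k → Hom (E k) (E (suc k))} {k l m}
      {hC : CohomologyAt C δC k} {hD : CohomologyAt D δD l} {hE : CohomologyAt E δE m}
      {g : Hom (C k) (D l)} {g' : Hom (D l) (E m)}
      (φ : CohomologyMap hC hD g) (ψ : CohomologyMap hD hE g')
      (c : Hom (Z hC) (Cin E δE m)) → g' ∘ (g ∘ z hC) ≈ δin E δE m ∘ c →
      CohomologyMap.map ψ ∘ CohomologyMap.map φ ≈ 0h
  composite-vanishes {E = E} {δE = δE} {m = m} {hC} {hD} {hE} {g} {g'} φ ψ c g'g≈δc =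
    epi-zero (p-epi hC) _ (begin
      (Ψ.map ∘ Φ.map) ∘ p hC                ≈⟨ assoc ⟩
      Ψ.map ∘ (Φ.map ∘ p hC)                ≈⟨ ∘-resp-≈ʳ Φ.map-comm ⟩
      Ψ.map ∘ (p hD ∘ Φ.onCocycles)         ≈⟨ sym-assoc ⟩
      (Ψ.map ∘ p hD) ∘ Φ.onCocycles         ≈⟨ ∘-resp-≈ˡ Ψ.map-comm ⟩
      (p hE ∘ Ψ.onCocycles) ∘ Φ.onCocycles  ≈⟨ assoc ⟩
      p hE ∘ (Ψ.onCocycles ∘ Φ.onCocycles)  ≈⟨ ∘-resp-≈ʳ onCocycles-bound ⟩
      p hE ∘ (u hE ∘ c)                     ≈⟨ sym-assoc ⟩
      (p hE ∘ u hE) ∘ c                     ≈⟨ ∘-resp-≈ˡ (p∘u hE) ⟩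
      0h ∘ c                                ≈⟨ ∘-zeroˡ c ⟩
      0h                                    ∎)
    where
    module Φ = CohomologyMap φ
    module Ψ = CohomologyMap ψ
    onCocycles-bound : Ψ.onCocycles ∘ Φ.onCocycles ≈ u hE ∘ c
    onCocycles-bound = z-mono hE _ _ (begin
      z hE ∘ (Ψ.onCocycles ∘ Φ.onCocycles)  ≈⟨ sym-assoc ⟩
      (z hE ∘ Ψ.onCocycles) ∘ Φ.onCocycles  ≈⟨ ∘-resp-≈ˡ Ψ.onCocycles-comm ⟩
      (g' ∘ z hD) ∘ Φ.onCocycles            ≈⟨ assoc ⟩
      g' ∘ (z hD ∘ Φ.onCocycles)            ≈⟨ ∘-resp-≈ʳ Φ.onCocycles-comm ⟩
      g' ∘ (g ∘ z hC)                       ≈⟨ g'g≈δc ⟩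
      δin E δE m ∘ c                        ≈⟨ ∘-resp-≈ˡ (u-fac hE) ⟨
      (z hE ∘ u hE) ∘ c                     ≈⟨ assoc ⟩
      z hE ∘ (u hE ∘ c)                     ∎)

-- The long exact cohomology sequence of a short exact sequence of cochain
-- complexes 0 → I → P → Q → 0 which splits in each degree (but not
-- necessarily compatibly with the differentials).
module SplitLongExactSequence {o ℓ e} (𝒜 : Abelian o ℓ e) where
  open Abelian 𝒜
  open AbelianChase 𝒜
  open Cohomology 𝒜
  open CohomologyFacts

  record DegreewiseSplit (CI CP CQ : ℕ → Obj)
      (δI : ∀ k → Hom (CI k) (CI (suc k))) (δP : ∀ k → Hom (CP k) (CP (suc k)))
      (δQ : ∀ k → Hom (CQ k) (CQ (suc k))) : Set (ℓ ⊔ e) where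
    field
      ι : ∀ k → Hom (CI k) (CP k)
      π : ∀ k → Hom (CP k) (CQ k)
      t : ∀ k → Hom (CP k) (CI k)
      s : ∀ k → Hom (CQ k) (CP k)
      t∘ι     : ∀ k → t k ∘ ι k ≈ id
      π∘s     : ∀ k → π k ∘ s k ≈ id
      π∘ι     : ∀ k → π k ∘ ι k ≈ 0h
      ι∘t+s∘π : ∀ k → ι k ∘ t k + s k ∘ π k ≈ id
      ι-chain : ∀ k → δP k ∘ ι k ≈ ι (suc k) ∘ δI k
      π-chain : ∀ k → δQ k ∘ π k ≈ π (suc k) ∘ δP k

  module LongExact {CI CP CQ : ℕ → Obj}
      {δI : ∀ k → Hom (CI k) (CI (suc k))} {δP : ∀ k → Hom (CP k) (CP (suc k))}
      {δQ : ∀ k → Hom (CQ k) (CQ (suc k))} (σ : DegreewiseSplit CI CP CQ δI δP δQ)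
      (hI : ∀ k → CohomologyAt CI δI k) (hP : ∀ k → CohomologyAt CP δP k)
      (hQ : ∀ k → CohomologyAt CQ δQ k) where
    open DegreewiseSplit σ

    module I (k : ℕ) = CohomologyFacts (hI k)
    module P (k : ℕ) = CohomologyFacts (hP k)
    module Q (k : ℕ) = CohomologyFacts (hQ k)

    ι-mono : ∀ k → Mono (ι k)
    ι-mono k = split-mono (t∘ι k)

    ι∘t-on-ker-π : ∀ k {Y} (X : Hom Y (CP k)) → π k ∘ X ≈ 0h → ι k ∘ (t k ∘ X) ≈ X
    ι∘t-on-ker-π k X πX≈0 = begin
      ι k ∘ (t k ∘ X)           ≈⟨ sym-assoc ⟩
      (ι k ∘ t k) ∘ X           ≈⟨ ∘-resp-≈ˡ (+≈⇒≈sub (ι∘t+s∘π k)) ⟩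
      (id - s k ∘ π k) ∘ X      ≈⟨ ∘-distribʳ-sub ⟩
      id ∘ X - (s k ∘ π k) ∘ X  ≈⟨ +-cong identityˡ (neg-cong (≈-trans assoc (∘-resp-≈ʳ πX≈0))) ⟩
      X - s k ∘ 0h              ≈⟨ +-cong ≈-refl (neg-cong (∘-zeroʳ _)) ⟩
      X - 0h                    ≈⟨ sub-zero X ⟩
      X                         ∎

    -- the connecting cochain map: lift along s, apply δ, project along t
    h : ∀ k → Hom (CQ k) (CI (suc k))
    h k = t (suc k) ∘ (δP k ∘ s k)

    -- the defect of s from being a cochain map is ι ∘ h
    ι∘h : ∀ k → ι (suc k) ∘ h k ≈ δP k ∘ s k - s (suc k) ∘ δQ k
    ι∘h k = begin
      ι (suc k) ∘ (t (suc k) ∘ (δP k ∘ s k))       ≈⟨ sym-assoc ⟩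
      (ι (suc k) ∘ t (suc k)) ∘ (δP k ∘ s k)       ≈⟨ ∘-resp-≈ˡ (+≈⇒≈sub (ι∘t+s∘π (suc k))) ⟩
      (id - s (suc k) ∘ π (suc k)) ∘ (δP k ∘ s k)  ≈⟨ ∘-distribʳ-sub ⟩
      id ∘ (δP k ∘ s k) - (s (suc k) ∘ π (suc k)) ∘ (δP k ∘ s k)
                                                    ≈⟨ +-cong identityˡ (neg-cong π-part) ⟩
      δP k ∘ s k - s (suc k) ∘ δQ k                ∎
      where
      π-part : (s (suc k) ∘ π (suc k)) ∘ (δP k ∘ s k) ≈ s (suc k) ∘ δQ k
      π-part = begin
        (s (suc k) ∘ π (suc k)) ∘ (δP k ∘ s k)  ≈⟨ ≈-trans assoc (∘-resp-≈ʳ sym-assoc) ⟩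
        s (suc k) ∘ ((π (suc k) ∘ δP k) ∘ s k)  ≈⟨ ∘-resp-≈ʳ (∘-resp-≈ˡ (π-chain k)) ⟨
        s (suc k) ∘ ((δQ k ∘ π k) ∘ s k)        ≈⟨ ∘-resp-≈ʳ (≈-trans assoc (∘-resp-≈ʳ (π∘s k))) ⟩
        s (suc k) ∘ (δQ k ∘ id)                 ≈⟨ ∘-resp-≈ʳ identityʳ ⟩
        s (suc k) ∘ δQ k                        ∎

    -- dually, the defect of t from being a cochain map is h ∘ π
    h∘π : ∀ k → h k ∘ π k ≈ t (suc k) ∘ δP k - δI k ∘ t k
    h∘π k = begin
      (t (suc k) ∘ (δP k ∘ s k)) ∘ π k       ≈⟨ ≈-trans assoc (∘-resp-≈ʳ assoc) ⟩
      t (suc k) ∘ (δP k ∘ (s k ∘ π k))       ≈⟨ ∘-resp-≈ʳ (∘-resp-≈ʳ (+≈⇒≈sub (≈-trans (+-comm _ _) (ι∘t+s∘π k)))) ⟩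
      t (suc k) ∘ (δP k ∘ (id - ι k ∘ t k))  ≈⟨ ≈-trans (∘-resp-≈ʳ ∘-distribˡ-sub) ∘-distribˡ-sub ⟩
      t (suc k) ∘ (δP k ∘ id) - t (suc k) ∘ (δP k ∘ (ι k ∘ t k))
                                                    ≈⟨ +-cong (∘-resp-≈ʳ identityʳ) (neg-cong ι-part) ⟩
      t (suc k) ∘ δP k - δI k ∘ t k          ∎
      where
      ι-part : t (suc k) ∘ (δP k ∘ (ι k ∘ t k)) ≈ δI k ∘ t k
      ι-part = begin
        t (suc k) ∘ (δP k ∘ (ι k ∘ t k))        ≈⟨ ∘-resp-≈ʳ sym-assoc ⟩
        t (suc k) ∘ ((δP k ∘ ι k) ∘ t k)        ≈⟨ ∘-resp-≈ʳ (∘-resp-≈ˡ (ι-chain k)) ⟩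
        t (suc k) ∘ ((ι (suc k) ∘ δI k) ∘ t k)  ≈⟨ ≈-trans (∘-resp-≈ʳ assoc) sym-assoc ⟩
        (t (suc k) ∘ ι (suc k)) ∘ (δI k ∘ t k)  ≈⟨ ≈-trans (∘-resp-≈ˡ (t∘ι (suc k))) identityˡ ⟩
        δI k ∘ t k                              ∎

    ι∘h∘z : ∀ k → ι (suc k) ∘ (h k ∘ Q.z k) ≈ δP k ∘ (s k ∘ Q.z k)
    ι∘h∘z k = begin
      ι (suc k) ∘ (h k ∘ Q.z k)                ≈⟨ sym-assoc ⟩
      (ι (suc k) ∘ h k) ∘ Q.z k                ≈⟨ ∘-resp-≈ˡ (ι∘h k) ⟩
      (δP k ∘ s k - s (suc k) ∘ δQ k) ∘ Q.z k  ≈⟨ ∘-distribʳ-sub ⟩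
      (δP k ∘ s k) ∘ Q.z k - (s (suc k) ∘ δQ k) ∘ Q.z k
                          ≈⟨ +-cong assoc (neg-cong (≈-trans assoc (∘-resp-≈ʳ (Q.δ∘z k)))) ⟩
      δP k ∘ (s k ∘ Q.z k) - s (suc k) ∘ 0h    ≈⟨ +-cong ≈-refl (neg-cong (∘-zeroʳ _)) ⟩
      δP k ∘ (s k ∘ Q.z k) - 0h                ≈⟨ sub-zero _ ⟩
      δP k ∘ (s k ∘ Q.z k)                     ∎

    ι∘δI : ∀ k {Y} (X : Hom Y (CI k)) → ι (suc k) ∘ (δI k ∘ X) ≈ δP k ∘ (ι k ∘ X)
    ι∘δI k X = ≈-trans sym-assoc (≈-trans (∘-resp-≈ˡ (≈-sym (ι-chain k))) assoc)

    h-cocycles : ∀ k → δI (suc k) ∘ (h k ∘ Q.z k) ≈ 0h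
    h-cocycles k = mono-zero (ι-mono (suc (suc k))) _ (begin
      ι (suc (suc k)) ∘ (δI (suc k) ∘ (h k ∘ Q.z k))  ≈⟨ ι∘δI (suc k) _ ⟩
      δP (suc k) ∘ (ι (suc k) ∘ (h k ∘ Q.z k))        ≈⟨ ∘-resp-≈ʳ (ι∘h∘z k) ⟩
      δP (suc k) ∘ (δP k ∘ (s k ∘ Q.z k))             ≈⟨ sym-assoc ⟩
      (δP (suc k) ∘ δP k) ∘ (s k ∘ Q.z k)             ≈⟨ ∘-resp-≈ˡ (P.δ∘δin (suc k)) ⟩
      0h ∘ (s k ∘ Q.z k)                              ≈⟨ ∘-zeroˡ _ ⟩
      0h                                              ∎)

    h-anticommutes : ∀ k → h (suc k) ∘ δQ k ≈ δI (suc k) ∘ (- h k)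
    h-anticommutes k = ι-mono (suc (suc k)) _ _ (begin
      ι (suc (suc k)) ∘ (h (suc k) ∘ δQ k)      ≈⟨ sym-assoc ⟩
      (ι (suc (suc k)) ∘ h (suc k)) ∘ δQ k      ≈⟨ ∘-resp-≈ˡ (ι∘h (suc k)) ⟩
      (δP (suc k) ∘ s (suc k) - s (suc (suc k)) ∘ δQ (suc k)) ∘ δQ k
                                                      ≈⟨ ∘-distribʳ-sub ⟩
      (δP (suc k) ∘ s (suc k)) ∘ δQ k - (s (suc (suc k)) ∘ δQ (suc k)) ∘ δQ k
          ≈⟨ +-cong assoc (neg-cong (≈-trans assoc (∘-resp-≈ʳ (Q.δ∘δin (suc k))))) ⟩
      δP (suc k) ∘ (s (suc k) ∘ δQ k) - s (suc (suc k)) ∘ 0h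
                                                      ≈⟨ +-cong ≈-refl (neg-cong (∘-zeroʳ _)) ⟩
      δP (suc k) ∘ (s (suc k) ∘ δQ k) - 0h      ≈⟨ sub-zero _ ⟩
      δP (suc k) ∘ (s (suc k) ∘ δQ k)           ≈⟨ neg-involutive _ ⟨
      - (- (δP (suc k) ∘ (s (suc k) ∘ δQ k)))   ≈⟨ neg-cong ι∘δI∘h ⟨
      - (ι (suc (suc k)) ∘ (δI (suc k) ∘ h k))  ≈⟨ ∘-negʳ _ _ ⟨
      ι (suc (suc k)) ∘ (- (δI (suc k) ∘ h k))  ≈⟨ ∘-resp-≈ʳ (∘-negʳ _ _) ⟨
      ι (suc (suc k)) ∘ (δI (suc k) ∘ (- h k))  ∎)
      where
      ι∘δI∘h : ι (suc (suc k)) ∘ (δI (suc k) ∘ h k) ≈ - (δP (suc k) ∘ (s (suc k) ∘ δQ k))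
      ι∘δI∘h = begin
        ι (suc (suc k)) ∘ (δI (suc k) ∘ h k)          ≈⟨ ι∘δI (suc k) _ ⟩
        δP (suc k) ∘ (ι (suc k) ∘ h k)                ≈⟨ ∘-resp-≈ʳ (ι∘h k) ⟩
        δP (suc k) ∘ (δP k ∘ s k - s (suc k) ∘ δQ k)  ≈⟨ ∘-distribˡ-sub ⟩
        δP (suc k) ∘ (δP k ∘ s k) - δP (suc k) ∘ (s (suc k) ∘ δQ k)
          ≈⟨ +-cong (≈-trans sym-assoc (≈-trans (∘-resp-≈ˡ (P.δ∘δin (suc k))) (∘-zeroˡ _))) ≈-refl ⟩
        0h - δP (suc k) ∘ (s (suc k) ∘ δQ k)          ≈⟨ +-identityˡ _ ⟩
        - (δP (suc k) ∘ (s (suc k) ∘ δQ k))           ∎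

    h-shifted : ∀ k → Hom (Cin CQ δQ k) (Cin CI δI (suc k))
    h-shifted zero    = 0h
    h-shifted (suc k) = - h k

    h-boundaries : ∀ k → h k ∘ δin CQ δQ k ≈ δin CI δI (suc k) ∘ h-shifted k
    h-boundaries zero    = ≈-trans (∘-zeroʳ _) (≈-sym (∘-zeroʳ _))
    h-boundaries (suc k) = h-anticommutes k

    i : ∀ k → CohomologyMap (hI k) (hP k) (ι k)
    i k = induced ι ι-chain (hI k) (hP k)

    r : ∀ k → CohomologyMap (hP k) (hQ k) (π k)
    r k = induced π π-chain (hP k) (hQ k)

    d : ∀ k → CohomologyMap (hQ k) (hI (suc k)) (h k)
    d k = descend (hQ k) (hI (suc k)) (h k) (h-cocycles k) (h-shifted k) (h-boundaries k)

    open CohomologyMap using (map)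

    r∘i≈0 : ∀ k → map (r k) ∘ map (i k) ≈ 0h
    r∘i≈0 k = composite-vanishes (i k) (r k) 0h (begin
      π k ∘ (ι k ∘ I.z k)  ≈⟨ sym-assoc ⟩
      (π k ∘ ι k) ∘ I.z k  ≈⟨ ∘-resp-≈ˡ (π∘ι k) ⟩
      0h ∘ I.z k           ≈⟨ ∘-zeroˡ _ ⟩
      0h                   ≈⟨ ∘-zeroʳ _ ⟨
      δin CQ δQ k ∘ 0h     ∎)

    d∘r≈0 : ∀ k → map (d k) ∘ map (r k) ≈ 0h
    d∘r≈0 k = composite-vanishes (r k) (d k) (- (t k ∘ P.z k)) (begin
      h k ∘ (π k ∘ P.z k)                                ≈⟨ sym-assoc ⟩
      (h k ∘ π k) ∘ P.z k                                ≈⟨ ∘-resp-≈ˡ (h∘π k) ⟩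
      (t (suc k) ∘ δP k - δI k ∘ t k) ∘ P.z k            ≈⟨ ∘-distribʳ-sub ⟩
      (t (suc k) ∘ δP k) ∘ P.z k - (δI k ∘ t k) ∘ P.z k  ≈⟨ +-cong (≈-trans assoc (∘-resp-≈ʳ (P.δ∘z k))) (neg-cong assoc) ⟩
      t (suc k) ∘ 0h - δI k ∘ (t k ∘ P.z k)              ≈⟨ +-cong (∘-zeroʳ _) ≈-refl ⟩
      0h - δI k ∘ (t k ∘ P.z k)                          ≈⟨ +-identityˡ _ ⟩
      - (δI k ∘ (t k ∘ P.z k))                           ≈⟨ ∘-negʳ _ _ ⟨
      δI k ∘ (- (t k ∘ P.z k))                           ∎)

    i∘d≈0 : ∀ k → map (i (suc k)) ∘ map (d k) ≈ 0h
    i∘d≈0 k = composite-vanishes (d k) (i (suc k)) (s k ∘ Q.z k) (ι∘h∘z k)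

    s-shifted : ∀ k → Hom (Cin CQ δQ k) (Cin CP δP k)
    s-shifted zero    = 0h
    s-shifted (suc k) = s k

    π∘δ∘s-shifted : ∀ k → π k ∘ (δin CP δP k ∘ s-shifted k) ≈ δin CQ δQ k
    π∘δ∘s-shifted zero    = from𝟘 _ _
    π∘δ∘s-shifted (suc k) = begin
      π (suc k) ∘ (δP k ∘ s k)  ≈⟨ sym-assoc ⟩
      (π (suc k) ∘ δP k) ∘ s k  ≈⟨ ∘-resp-≈ˡ (π-chain k) ⟨
      (δQ k ∘ π k) ∘ s k        ≈⟨ assoc ⟩
      δQ k ∘ (π k ∘ s k)        ≈⟨ ∘-resp-≈ʳ (π∘s k) ⟩
      δQ k ∘ id                 ≈⟨ identityʳ ⟩
      δQ k                      ∎

    -- exactness at H^k(P): a class killed by r is represented by a cocycle y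
    -- with π y = δ c; then y - δ (s c) lies in the kernel of π, i.e. in the
    -- image of ι
    exact-at-P : ∀ k → Exact (map (i k)) (map (r k))
    exact-at-P k = exact-by-lifting (r∘i≈0 k) lifting
      where
      lifting : ∀ {X} (x : Hom X (P.H k)) → map (r k) ∘ x ≈ 0h → Lift (map (i k)) x
      lifting x rx≈0 = lift-by-cocycle (i k) cover-epi y (≈-trans (P.p-shift k cocycle c) represents)
                                       α α-cocycle ια≈zy
        where
        open KernelChase (kernel-chase (r k) x rx≈0)
        c : Hom Cover (Cin CP δP k)
        c = s-shifted k ∘ witness
        y : Hom Cover (P.Z k)
        y = cocycle - P.u k ∘ c
        πzy≈0 : π k ∘ (P.z k ∘ y) ≈ 0h
        πzy≈0 = begin
          π k ∘ (P.z k ∘ y)                                  ≈⟨ ∘-resp-≈ʳ (P.z-shift k cocycle c) ⟩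
          π k ∘ (P.z k ∘ cocycle - δin CP δP k ∘ c)          ≈⟨ ∘-distribˡ-sub ⟩
          π k ∘ (P.z k ∘ cocycle) - π k ∘ (δin CP δP k ∘ c)  ≈⟨ +-cong bounds (neg-cong π∘δ∘c) ⟩
          δin CQ δQ k ∘ witness - δin CQ δQ k ∘ witness      ≈⟨ +-inverseʳ _ ⟩
          0h                                                 ∎
          where
          π∘δ∘c : π k ∘ (δin CP δP k ∘ c) ≈ δin CQ δQ k ∘ witness
          π∘δ∘c = ≈-trans (∘-resp-≈ʳ sym-assoc)
                    (≈-trans sym-assoc (∘-resp-≈ˡ (π∘δ∘s-shifted k)))
        α : Hom Cover (CI k)
        α = t k ∘ (P.z k ∘ y)
        ια≈zy : ι k ∘ α ≈ P.z k ∘ y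
        ια≈zy = ι∘t-on-ker-π k _ πzy≈0
        α-cocycle : δI k ∘ α ≈ 0h
        α-cocycle = mono-zero (ι-mono (suc k)) _ (begin
          ι (suc k) ∘ (δI k ∘ α)  ≈⟨ ι∘δI k α ⟩
          δP k ∘ (ι k ∘ α)        ≈⟨ ∘-resp-≈ʳ ια≈zy ⟩
          δP k ∘ (P.z k ∘ y)      ≈⟨ P.δ∘z∘ k y ⟩
          0h                      ∎)

    -- exactness at H^k(Q): a class killed by d is represented by a cocycle y
    -- with h y = δ c; then s y - ι c is a cocycle of P mapping to y
    exact-at-Q : ∀ k → Exact (map (r k)) (map (d k))
    exact-at-Q k = exact-by-lifting (d∘r≈0 k) lifting
      where
      lifting : ∀ {X} (x : Hom X (Q.H k)) → map (d k) ∘ x ≈ 0h → Lift (map (r k)) x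
      lifting x dx≈0 = lift-by-cocycle (r k) cover-epi cocycle represents α α-cocycle πα≈zy
        where
        open KernelChase (kernel-chase (d k) x dx≈0)
        α : Hom Cover (CP k)
        α = s k ∘ (Q.z k ∘ cocycle) - ι k ∘ witness
        s-part : δP k ∘ (s k ∘ (Q.z k ∘ cocycle)) ≈ ι (suc k) ∘ (δI k ∘ witness)
        s-part = begin
          δP k ∘ (s k ∘ (Q.z k ∘ cocycle))       ≈⟨ ≈-trans (∘-resp-≈ʳ sym-assoc) sym-assoc ⟩
          (δP k ∘ (s k ∘ Q.z k)) ∘ cocycle       ≈⟨ ∘-resp-≈ˡ (ι∘h∘z k) ⟨
          (ι (suc k) ∘ (h k ∘ Q.z k)) ∘ cocycle  ≈⟨ ≈-trans assoc (∘-resp-≈ʳ assoc) ⟩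
          ι (suc k) ∘ (h k ∘ (Q.z k ∘ cocycle))  ≈⟨ ∘-resp-≈ʳ bounds ⟩
          ι (suc k) ∘ (δI k ∘ witness)           ∎
        α-cocycle : δP k ∘ α ≈ 0h
        α-cocycle = begin
          δP k ∘ α                                                     ≈⟨ ∘-distribˡ-sub ⟩
          δP k ∘ (s k ∘ (Q.z k ∘ cocycle)) - δP k ∘ (ι k ∘ witness)    ≈⟨ +-cong s-part (neg-cong (≈-sym (ι∘δI k witness))) ⟩
          ι (suc k) ∘ (δI k ∘ witness) - ι (suc k) ∘ (δI k ∘ witness)  ≈⟨ +-inverseʳ _ ⟩
          0h                                                           ∎
        πα≈zy : π k ∘ α ≈ Q.z k ∘ cocycle
        πα≈zy = begin
          π k ∘ α               ≈⟨ ∘-distribˡ-sub ⟩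
          π k ∘ (s k ∘ (Q.z k ∘ cocycle)) - π k ∘ (ι k ∘ witness)
            ≈⟨ +-cong (≈-trans sym-assoc (≈-trans (∘-resp-≈ˡ (π∘s k)) identityˡ))
                      (neg-cong (≈-trans sym-assoc (≈-trans (∘-resp-≈ˡ (π∘ι k)) (∘-zeroˡ _)))) ⟩
          Q.z k ∘ cocycle - 0h  ≈⟨ sub-zero _ ⟩
          Q.z k ∘ cocycle       ∎

    -- exactness at H^{k+1}(I): a class killed by i is represented by a cocycle
    -- y with ι y = δ c; then π c is a cocycle of Q and h (π c) = y - δ (t c)
    exact-at-I : ∀ k → Exact (map (d k)) (map (i (suc k)))
    exact-at-I k = exact-by-lifting (i∘d≈0 k) lifting
      where
      lifting : ∀ {X} (x : Hom X (I.H (suc k))) → map (i (suc k)) ∘ x ≈ 0h → Lift (map (d k)) x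
      lifting x ix≈0 = lift-by-cocycle (d k) cover-epi y (≈-trans (I.p-shift (suc k) cocycle c) represents)
                                       α α-cocycle hα≈zy
        where
        open KernelChase (kernel-chase (i (suc k)) x ix≈0)
        c : Hom Cover (CI k)
        c = t k ∘ witness
        y : Hom Cover (I.Z (suc k))
        y = cocycle - I.u (suc k) ∘ c
        α : Hom Cover (CQ k)
        α = π k ∘ witness
        α-cocycle : δQ k ∘ α ≈ 0h
        α-cocycle = begin
          δQ k ∘ (π k ∘ witness)                             ≈⟨ sym-assoc ⟩
          (δQ k ∘ π k) ∘ witness                             ≈⟨ ∘-resp-≈ˡ (π-chain k) ⟩
          (π (suc k) ∘ δP k) ∘ witness                       ≈⟨ assoc ⟩
          π (suc k) ∘ (δP k ∘ witness)                       ≈⟨ ∘-resp-≈ʳ bounds ⟨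
          π (suc k) ∘ (ι (suc k) ∘ (I.z (suc k) ∘ cocycle))  ≈⟨ sym-assoc ⟩
          (π (suc k) ∘ ι (suc k)) ∘ (I.z (suc k) ∘ cocycle)  ≈⟨ ∘-resp-≈ˡ (π∘ι (suc k)) ⟩
          0h ∘ (I.z (suc k) ∘ cocycle)                       ≈⟨ ∘-zeroˡ _ ⟩
          0h                                                 ∎
        t-part : (t (suc k) ∘ δP k) ∘ witness ≈ I.z (suc k) ∘ cocycle
        t-part = begin
          (t (suc k) ∘ δP k) ∘ witness                       ≈⟨ assoc ⟩
          t (suc k) ∘ (δP k ∘ witness)                       ≈⟨ ∘-resp-≈ʳ bounds ⟨
          t (suc k) ∘ (ι (suc k) ∘ (I.z (suc k) ∘ cocycle))  ≈⟨ sym-assoc ⟩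
          (t (suc k) ∘ ι (suc k)) ∘ (I.z (suc k) ∘ cocycle)  ≈⟨ ≈-trans (∘-resp-≈ˡ (t∘ι (suc k))) identityˡ ⟩
          I.z (suc k) ∘ cocycle                              ∎
        hα≈zy : h k ∘ α ≈ I.z (suc k) ∘ y
        hα≈zy = begin
          h k ∘ (π k ∘ witness)                                  ≈⟨ sym-assoc ⟩
          (h k ∘ π k) ∘ witness                                  ≈⟨ ∘-resp-≈ˡ (h∘π k) ⟩
          (t (suc k) ∘ δP k - δI k ∘ t k) ∘ witness              ≈⟨ ∘-distribʳ-sub ⟩
          (t (suc k) ∘ δP k) ∘ witness - (δI k ∘ t k) ∘ witness  ≈⟨ +-cong t-part (neg-cong assoc) ⟩
          I.z (suc k) ∘ cocycle - δI k ∘ c                       ≈⟨ I.z-shift (suc k) cocycle c ⟨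
          I.z (suc k) ∘ y                                        ∎

    -- the sequence starts with 0 → H^0(I): a class killed by i is represented
    -- by a cocycle y with ι y = δ 0 = 0, so y = 0
    i₀-mono : Mono (map (i 0))
    i₀-mono = mono-by-zero vanishes
      where
      vanishes : ∀ {X} (x : Hom X (I.H 0)) → map (i 0) ∘ x ≈ 0h → x ≈ 0h
      vanishes x ix≈0 = epi-zero cover-epi x (begin
        x ∘ cover        ≈⟨ represents ⟨
        I.p 0 ∘ cocycle  ≈⟨ ∘-resp-≈ʳ cocycle≈0 ⟩
        I.p 0 ∘ 0h       ≈⟨ ∘-zeroʳ _ ⟩
        0h               ∎)
        where
        open KernelChase (kernel-chase (i 0) x ix≈0)
        cocycle≈0 : cocycle ≈ 0h
        cocycle≈0 = mono-zero (I.z-mono 0) cocycle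
                      (mono-zero (ι-mono 0) _ (≈-trans bounds (∘-zeroˡ witness)))

module Matrices {o ℓ e} (𝒜 : Abelian o ℓ e) (P : FinPoset)
                (G : PosetDefs.Grading P) (F : Functor P 𝒜)
                (c : PosetDefs.Coloring P) where
  open Abelian 𝒜
  open AbelianChase 𝒜
  open PosetDefs P
  open Functor F
  open CochainComplex 𝒜 P G F c
  open Grading G

  prj∘inj : ∀ L (i : Fin (length L)) → prj L i ∘ inj L i ≈ id
  prj∘inj (x ∷ L) fzero    = π₁ι₁
  prj∘inj (x ∷ L) (fsuc i) = begin
    (prj L i ∘ π₂) ∘ (ι₂ ∘ inj L i)  ≈⟨ ≈-trans assoc (∘-resp-≈ʳ sym-assoc) ⟩
    prj L i ∘ ((π₂ ∘ ι₂) ∘ inj L i)  ≈⟨ ∘-resp-≈ʳ (≈-trans (∘-resp-≈ˡ π₂ι₂) identityˡ) ⟩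
    prj L i ∘ inj L i                ≈⟨ prj∘inj L i ⟩
    id                               ∎

  prj∘inj-≢ : ∀ L (i j : Fin (length L)) → i ≢ j → prj L j ∘ inj L i ≈ 0h
  prj∘inj-≢ (x ∷ L) fzero    fzero    i≢j = ⊥-elim (i≢j refl)
  prj∘inj-≢ (x ∷ L) fzero    (fsuc j) i≢j =
    ≈-trans assoc (≈-trans (∘-resp-≈ʳ π₂ι₁) (∘-zeroʳ _))
  prj∘inj-≢ (x ∷ L) (fsuc i) fzero    i≢j =
    ≈-trans sym-assoc (≈-trans (∘-resp-≈ˡ π₁ι₂) (∘-zeroˡ _))
  prj∘inj-≢ (x ∷ L) (fsuc i) (fsuc j) i≢j = begin
    (prj L j ∘ π₂) ∘ (ι₂ ∘ inj L i)  ≈⟨ ≈-trans assoc (∘-resp-≈ʳ sym-assoc) ⟩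
    prj L j ∘ ((π₂ ∘ ι₂) ∘ inj L i)  ≈⟨ ∘-resp-≈ʳ (≈-trans (∘-resp-≈ˡ π₂ι₂) identityˡ) ⟩
    prj L j ∘ inj L i                ≈⟨ prj∘inj-≢ L i j (λ i≡j → i≢j (cong fsuc i≡j)) ⟩
    0h                               ∎

  Σinj∘prj≈id : ∀ L → hsum (length L) (λ i → inj L i ∘ prj L i) ≈ id
  Σinj∘prj≈id []      = from𝟘 _ _
  Σinj∘prj≈id (x ∷ L) = begin
    ι₁ ∘ π₁ + hsum (length L) (λ i → (ι₂ ∘ inj L i) ∘ (prj L i ∘ π₂))
      ≈⟨ +-cong ≈-refl (hsum-cong (length L) (λ i → ≈-trans assoc (∘-resp-≈ʳ sym-assoc))) ⟩
    ι₁ ∘ π₁ + hsum (length L) (λ i → ι₂ ∘ ((inj L i ∘ prj L i) ∘ π₂))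
      ≈⟨ +-cong ≈-refl (hsum-∘ʳ (length L) _ ι₂) ⟨
    ι₁ ∘ π₁ + ι₂ ∘ hsum (length L) (λ i → (inj L i ∘ prj L i) ∘ π₂)
      ≈⟨ +-cong ≈-refl (∘-resp-≈ʳ (hsum-∘ˡ (length L) _ π₂)) ⟨
    ι₁ ∘ π₁ + ι₂ ∘ (hsum (length L) (λ i → inj L i ∘ prj L i) ∘ π₂)
      ≈⟨ +-cong ≈-refl (∘-resp-≈ʳ (≈-trans (∘-resp-≈ˡ (Σinj∘prj≈id L)) identityˡ)) ⟩
    ι₁ ∘ π₁ + ι₂ ∘ π₂  ≈⟨ ιπ ⟩
    id                 ∎

  entry : ∀ L M → Hom (⨁ L) (⨁ M) → (i : Fin (length L)) (j : Fin (length M)) →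
          Hom (F₀ (lookup L i)) (F₀ (lookup M j))
  entry L M f i j = prj M j ∘ (f ∘ inj L i)

  entries-determine : ∀ L M (f g : Hom (⨁ L) (⨁ M)) →
    (∀ i j → entry L M f i j ≈ entry L M g i j) → f ≈ g
  entries-determine L M f g same = ≈-trans (expand f)
    (≈-trans (hsum-cong (length M) (λ j → ∘-resp-≈ʳ (hsum-cong (length L) (λ i → ∘-resp-≈ˡ (same i j)))))
             (≈-sym (expand g)))
    where
    expand : ∀ f → f ≈ hsum (length M) λ j → inj M j ∘ hsum (length L) λ i → entry L M f i j ∘ prj L i
    expand f = begin
      f                                              ≈⟨ identityˡ ⟨
      id ∘ f                                         ≈⟨ ∘-resp-≈ˡ (Σinj∘prj≈id M) ⟨
      hsum (length M) (λ j → inj M j ∘ prj M j) ∘ f  ≈⟨ hsum-∘ˡ (length M) _ f ⟩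
      hsum (length M) (λ j → (inj M j ∘ prj M j) ∘ f)
        ≈⟨ hsum-cong (length M) (λ j → ≈-trans assoc (∘-resp-≈ʳ (row j))) ⟩
      _                                              ∎
      where
      row : ∀ j → prj M j ∘ f ≈ hsum (length L) λ i → entry L M f i j ∘ prj L i
      row j = begin
        prj M j ∘ f                                                ≈⟨ ∘-resp-≈ʳ identityʳ ⟨
        prj M j ∘ (f ∘ id)                                         ≈⟨ ∘-resp-≈ʳ (∘-resp-≈ʳ (Σinj∘prj≈id L)) ⟨
        prj M j ∘ (f ∘ hsum (length L) (λ i → inj L i ∘ prj L i))  ≈⟨ ∘-resp-≈ʳ (hsum-∘ʳ (length L) _ f) ⟩
        prj M j ∘ hsum (length L) (λ i → f ∘ (inj L i ∘ prj L i))  ≈⟨ hsum-∘ʳ (length L) _ (prj M j) ⟩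
        hsum (length L) (λ i → prj M j ∘ (f ∘ (inj L i ∘ prj L i)))
          ≈⟨ hsum-cong (length L) (λ i → ≈-trans (∘-resp-≈ʳ sym-assoc) sym-assoc) ⟩
        hsum (length L) (λ i → entry L M f i j ∘ prj L i)          ∎

  matrix-entry : ∀ L M m i j → entry L M (matrix L M m) i j ≈ m i j
  matrix-entry L M m i j = begin
    prj M j ∘ (matrix L M m ∘ inj L i)                      ≈⟨ ∘-resp-≈ʳ (hsum-∘ˡ (length L) _ _) ⟩
    prj M j ∘ hsum (length L) (λ i' → column i' ∘ inj L i)  ≈⟨ ∘-resp-≈ʳ (hsum-single (length L) i _ off-column) ⟩
    prj M j ∘ (column i ∘ inj L i)                          ≈⟨ ∘-resp-≈ʳ (≈-trans (hsum-∘ˡ (length M) _ _) (hsum-cong (length M) (λ j' → on-column j'))) ⟩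
    prj M j ∘ hsum (length M) (λ j' → inj M j' ∘ m i j')    ≈⟨ hsum-∘ʳ (length M) _ _ ⟩
    hsum (length M) (λ j' → prj M j ∘ (inj M j' ∘ m i j'))  ≈⟨ hsum-single (length M) j _ off-row ⟩
    prj M j ∘ (inj M j ∘ m i j)                             ≈⟨ ≈-trans sym-assoc (≈-trans (∘-resp-≈ˡ (prj∘inj M j)) identityˡ) ⟩
    m i j                                                   ∎
    where
    column : ∀ i' → Hom (⨁ L) (⨁ M)
    column i' = hsum (length M) λ j' → inj M j' ∘ (m i' j' ∘ prj L i')
    on-column : ∀ j' → (inj M j' ∘ (m i j' ∘ prj L i)) ∘ inj L i ≈ inj M j' ∘ m i j'
    on-column j' = ≈-trans assoc (∘-resp-≈ʳ (≈-trans assoc (≈-trans (∘-resp-≈ʳ (prj∘inj L i)) identityʳ)))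
    off-column : ∀ i' → i' ≢ i → column i' ∘ inj L i ≈ 0h
    off-column i' i'≢i = ≈-trans (hsum-∘ˡ (length M) _ _) (hsum-zero (length M) λ j' →
      ≈-trans assoc (≈-trans (∘-resp-≈ʳ (≈-trans assoc (≈-trans (∘-resp-≈ʳ (prj∘inj-≢ L i i' (λ q → i'≢i (sym q)))) (∘-zeroʳ _)))) (∘-zeroʳ _)))
    off-row : ∀ j' → j' ≢ j → prj M j ∘ (inj M j' ∘ m i j') ≈ 0h
    off-row j' j'≢j = ≈-trans sym-assoc (≈-trans (∘-resp-≈ˡ (prj∘inj-≢ M j' j j'≢j)) (∘-zeroˡ _))

  matrix-∘-entry : ∀ L M N (a b : ∀ x y → Hom (F₀ x) (F₀ y)) i k →
    entry L N (matrix M N (λ j k → b (lookup M j) (lookup N k)) ∘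
               matrix L M (λ i j → a (lookup L i) (lookup M j))) i k
      ≈ hsum (length M) (λ j → b (lookup M j) (lookup N k) ∘ a (lookup L i) (lookup M j))
  matrix-∘-entry L M N a b i k = begin
    prj N k ∘ ((B ∘ A) ∘ inj L i)         ≈⟨ ≈-trans (∘-resp-≈ʳ assoc) sym-assoc ⟩
    (prj N k ∘ B) ∘ (A ∘ inj L i)         ≈⟨ ∘-resp-≈ʳ identityˡ ⟨
    (prj N k ∘ B) ∘ (id ∘ (A ∘ inj L i))  ≈⟨ ∘-resp-≈ʳ (∘-resp-≈ˡ (Σinj∘prj≈id M)) ⟨
    (prj N k ∘ B) ∘ (hsum (length M) (λ j → inj M j ∘ prj M j) ∘ (A ∘ inj L i))
                                                                    ≈⟨ ∘-resp-≈ʳ (hsum-∘ˡ (length M) _ _) ⟩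
    (prj N k ∘ B) ∘ hsum (length M) (λ j → (inj M j ∘ prj M j) ∘ (A ∘ inj L i))
                                                                    ≈⟨ hsum-∘ʳ (length M) _ _ ⟩
    hsum (length M) (λ j → (prj N k ∘ B) ∘ ((inj M j ∘ prj M j) ∘ (A ∘ inj L i)))
      ≈⟨ hsum-cong (length M) (λ j → ≈-trans (∘-resp-≈ʳ assoc) (≈-trans sym-assoc (∘-resp-≈ˡ assoc))) ⟩
    hsum (length M) (λ j → entry M N B j k ∘ entry L M A i j)
      ≈⟨ hsum-cong (length M) (λ j → ∘-resp-≈ (matrix-entry M N _ j k) (matrix-entry L M _ i j)) ⟩
    hsum (length M) (λ j → b (lookup M j) (lookup N k) ∘ a (lookup L i) (lookup M j)) ∎
    where
    A : Hom (⨁ L) (⨁ M)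
    A = matrix L M (λ i j → a (lookup L i) (lookup M j))
    B : Hom (⨁ M) (⨁ N)
    B = matrix M N (λ j k → b (lookup M j) (lookup N k))

  eq-entry-refl : ∀ x → eq-entry x x ≈ id
  eq-entry-refl x with x ≟ x
  ... | yes refl = ≈-refl
  ... | no x≢x   = ⊥-elim (x≢x refl)

  eq-entry-≢ : ∀ {x y} → x ≢ y → eq-entry x y ≈ 0h
  eq-entry-≢ {x} {y} x≢y with x ≟ y
  ... | yes refl = ⊥-elim (x≢y refl)
  ... | no _     = ≈-refl

  select-right-∉ : ∀ {B} M (g : ∀ z → Hom (F₀ z) B) y → y ∉ M →
    hsum (length M) (λ j → g (lookup M j) ∘ eq-entry y (lookup M j)) ≈ 0h
  select-right-∉ []      g y y∉ = ≈-refl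
  select-right-∉ (m ∷ M) g y y∉ = ≈-trans
    (+-cong (≈-trans (∘-resp-≈ʳ (eq-entry-≢ (λ q → y∉ (here q)))) (∘-zeroʳ _))
            (select-right-∉ M g y (λ y∈ → y∉ (there y∈))))
    (+-identityˡ 0h)

  select-right-∈ : ∀ {B} M (g : ∀ z → Hom (F₀ z) B) y → Unique M → y ∈ M →
    hsum (length M) (λ j → g (lookup M j) ∘ eq-entry y (lookup M j)) ≈ g y
  select-right-∈ (m ∷ M) g .m (m∉M ∷ _) (here refl) = ≈-trans
    (+-cong (≈-trans (∘-resp-≈ʳ (eq-entry-refl m)) identityʳ)
            (select-right-∉ M g m (λ m∈ → All.lookup m∉M m∈ refl)))
    (+-identityʳ _)
  select-right-∈ (m ∷ M) g y (m∉M ∷ uM) (there y∈) = ≈-trans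
    (+-cong (≈-trans (∘-resp-≈ʳ (eq-entry-≢ (λ q → All.lookup m∉M y∈ (sym q)))) (∘-zeroʳ _))
            (select-right-∈ M g y uM y∈))
    (+-identityˡ _)

  select-left-∉ : ∀ {A} M (g : ∀ z → Hom A (F₀ z)) y → y ∉ M →
    hsum (length M) (λ j → eq-entry (lookup M j) y ∘ g (lookup M j)) ≈ 0h
  select-left-∉ []      g y y∉ = ≈-refl
  select-left-∉ (m ∷ M) g y y∉ = ≈-trans
    (+-cong (≈-trans (∘-resp-≈ˡ (eq-entry-≢ (λ q → y∉ (here (sym q))))) (∘-zeroˡ _))
            (select-left-∉ M g y (λ y∈ → y∉ (there y∈))))
    (+-identityˡ 0h)

  select-left-∈ : ∀ {A} M (g : ∀ z → Hom A (F₀ z)) y → Unique M → y ∈ M →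
    hsum (length M) (λ j → eq-entry (lookup M j) y ∘ g (lookup M j)) ≈ g y
  select-left-∈ (m ∷ M) g .m (m∉M ∷ _) (here refl) = ≈-trans
    (+-cong (≈-trans (∘-resp-≈ˡ (eq-entry-refl m)) identityˡ)
            (select-left-∉ M g m (λ m∈ → All.lookup m∉M m∈ refl)))
    (+-identityʳ _)
  select-left-∈ (m ∷ M) g y (m∉M ∷ uM) (there y∈) = ≈-trans
    (+-cong (≈-trans (∘-resp-≈ˡ (eq-entry-≢ (λ q → All.lookup m∉M y∈ q))) (∘-zeroˡ _))
            (select-left-∈ M g y uM y∈))
    (+-identityˡ _)

  lookup-injective : ∀ (L : List Elt) → Unique L → ∀ i j → lookup L i ≡ lookup L j → i ≡ j
  lookup-injective (x ∷ L) _         fzero    fzero    _ = refl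
  lookup-injective (x ∷ L) (x∉L ∷ _) fzero    (fsuc j) q = ⊥-elim (All.lookup x∉L (∈-lookup j) q)
  lookup-injective (x ∷ L) (x∉L ∷ _) (fsuc i) fzero    q = ⊥-elim (All.lookup x∉L (∈-lookup i) (sym q))
  lookup-injective (x ∷ L) (_ ∷ uL)  (fsuc i) (fsuc j) q = cong fsuc (lookup-injective L uL i j q)

  T-not⇒¬T : ∀ b → T (not b) → ¬ T b
  T-not⇒¬T true  () _
  T-not⇒¬T false _  ()

  elems-unique : ∀ S k → Unique (elems S k)
  elems-unique S k = Unique.filter⁺ (λ x → T? (S x ∧ (rk x ≡ᵇ k))) (Unique.allFin⁺ n)

  ∈-elems : ∀ {S k x} → T (S x) → rk x ≡ k → x ∈ elems S k
  ∈-elems {S} {k} {x} Sx rk≡k = ∈-filter⁺ (λ x → T? (S x ∧ (rk x ≡ᵇ k))) (∈-allFin x)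
    (Equivalence.from T-∧ (Sx , ≡⇒≡ᵇ _ _ rk≡k))

  elems-∈ : ∀ {S k x} → x ∈ elems S k → T (S x) × rk x ≡ k
  elems-∈ {S} {k} x∈ =
    let (Sx , rk≡k) = Equivalence.to T-∧ (proj₂ (∈-filter⁻ (λ x → T? (S x ∧ (rk x ≡ᵇ k))) {xs = allFin n} x∈))
    in Sx , ≡ᵇ⇒≡ _ _ rk≡k

  elt : ∀ S k → Fin (length (elems S k)) → Elt
  elt S k i = lookup (elems S k) i

  elt-∈ : ∀ S k i → T (S (elt S k i))
  elt-∈ S k i = proj₁ (elems-∈ (∈-lookup {xs = elems S k} i))

  elt-rk : ∀ S k i → rk (elt S k i) ≡ k
  elt-rk S k i = proj₂ (elems-∈ (∈-lookup {xs = elems S k} i))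

  ∈-elems-elt : ∀ {R} S k i → T (S (elt R k i)) → elt R k i ∈ elems S k
  ∈-elems-elt {R} S k i Sx = ∈-elems Sx (elt-rk R k i)

  ∉-elems : ∀ {S k x} → T (not (S x)) → x ∉ elems S k
  ∉-elems {S} {x = x} ¬Sx x∈ = T-not⇒¬T (S x) ¬Sx (proj₁ (elems-∈ x∈))

  decide : ∀ b → T b ⊎ T (not b)
  decide true  = inj₁ tt
  decide false = inj₂ tt

  canon∘canon-entry : ∀ R S S' k i j →
    entry (elems R k) (elems S' k) (canon S S' k ∘ canon R S k) i j ≈
    hsum (length (elems S k)) (λ l → eq-entry (elt S k l) (elt S' k j) ∘ eq-entry (elt R k i) (elt S k l))
  canon∘canon-entry R S S' k = matrix-∘-entry (elems R k) (elems S k) (elems S' k) eq-entry eq-entry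

  canon-entry : ∀ S S' k i j → entry (elems S k) (elems S' k) (canon S S' k) i j ≈ eq-entry (elt S k i) (elt S' k j)
  canon-entry S S' k = matrix-entry (elems S k) (elems S' k) _

  canon-comp : ∀ {R S S'} → (∀ {x} → T (R x) → T (S' x) → T (S x)) →
               ∀ k → canon S S' k ∘ canon R S k ≈ canon R S' k
  canon-comp {R} {S} {S'} R∩S'⊆S k = entries-determine (elems R k) (elems S' k) _ _ λ i j →
    ≈-trans (canon∘canon-entry R S S' k i j)
            (≈-trans (by-cases i j (decide (S (elt R k i)))) (≈-sym (canon-entry R S' k i j)))
    where
    by-cases : ∀ i j → T (S (elt R k i)) ⊎ T (not (S (elt R k i))) →
      hsum (length (elems S k)) (λ l → eq-entry (elt S k l) (elt S' k j) ∘ eq-entry (elt R k i) (elt S k l))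
        ≈ eq-entry (elt R k i) (elt S' k j)
    by-cases i j (inj₁ Sx) = select-right-∈ (elems S k) (λ z → eq-entry z (elt S' k j)) _
                               (elems-unique S k) (∈-elems-elt S k i Sx)
    by-cases i j (inj₂ ¬Sx) = ≈-trans (select-right-∉ (elems S k) (λ z → eq-entry z (elt S' k j)) _ (∉-elems ¬Sx))
      (≈-sym (eq-entry-≢ λ x≡y → ∉-elems ¬Sx (∈-elems-elt S k i
        (R∩S'⊆S (elt-∈ R k i) (subst (λ z → T (S' z)) (sym x≡y) (elt-∈ S' k j))))))

  canon-id : ∀ S k → canon S S k ≈ id
  canon-id S k = entries-determine (elems S k) (elems S k) _ _ λ i j →
    ≈-trans (canon-entry S S k i j) (≈-sym (id-entry i j))
    where
    id-entry : ∀ i j → entry (elems S k) (elems S k) id i j ≈ eq-entry (elt S k i) (elt S k j)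
    id-entry i j with i ≟ j
    ... | yes refl = ≈-trans (∘-resp-≈ʳ identityˡ) (≈-trans (prj∘inj (elems S k) i) (≈-sym (eq-entry-refl _)))
    ... | no i≢j   = ≈-trans (∘-resp-≈ʳ identityˡ) (≈-trans (prj∘inj-≢ (elems S k) i j i≢j)
                       (≈-sym (eq-entry-≢ (λ q → i≢j (lookup-injective (elems S k) (elems-unique S k) i j q)))))

  canon-disjoint : ∀ {S S'} → (∀ {x} → T (S x) → T (S' x) → ⊥) → ∀ k → canon S S' k ≈ 0h
  canon-disjoint {S} {S'} disjoint k = entries-determine (elems S k) (elems S' k) _ _ λ i j →
    ≈-trans (canon-entry S S' k i j)
      (≈-trans (eq-entry-≢ (λ x≡y → disjoint (elt-∈ S k i) (subst (λ z → T (S' z)) (sym x≡y) (elt-∈ S' k j))))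
               (≈-sym (≈-trans (∘-resp-≈ʳ (∘-zeroˡ _)) (∘-zeroʳ _))))

  -- every element of rank k lies either in S or in its complement
  canon-partition : ∀ S k →
    canon S (λ _ → true) k ∘ canon (λ _ → true) S k +
    canon (λ x → not (S x)) (λ _ → true) k ∘ canon (λ _ → true) (λ x → not (S x)) k ≈ id
  canon-partition S k = ≈-trans (entries-determine (elems all k) (elems all k) _ _ λ i j →
      ≈-trans (≈-trans (∘-resp-≈ʳ ∘-distribʳ) ∘-distribˡ)
        (≈-trans (+-cong (canon∘canon-entry all S all k i j) (canon∘canon-entry all S̅ all k i j))
          (≈-trans (by-cases i j (decide (S (elt all k i)))) (≈-sym (canon-entry all all k i j)))))
    (canon-id all k)
    where
    all S̅ : Elt → Bool
    all _ = true
    S̅ x = not (S x)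
    selected : ∀ R x y → Hom (F₀ x) (F₀ y)
    selected R x y = hsum (length (elems R k)) (λ l → eq-entry (elt R k l) y ∘ eq-entry x (elt R k l))
    by-cases : ∀ i j → T (S (elt all k i)) ⊎ T (S̅ (elt all k i)) →
      selected S (elt all k i) (elt all k j) + selected S̅ (elt all k i) (elt all k j)
        ≈ eq-entry (elt all k i) (elt all k j)
    by-cases i j (inj₁ Sx) = ≈-trans
      (+-cong (select-right-∈ (elems S k) (λ z → eq-entry z (elt all k j)) _ (elems-unique S k) (∈-elems-elt S k i Sx))
              (select-right-∉ (elems S̅ k) (λ z → eq-entry z (elt all k j)) _
                 (λ x∈ → ∉-elems {S̅} (subst T (sym (not-involutive _)) Sx) x∈)))
      (+-identityʳ _)
    by-cases i j (inj₂ S̅x) = ≈-trans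
      (+-cong (select-right-∉ (elems S k) (λ z → eq-entry z (elt all k j)) _ (∉-elems S̅x))
              (select-right-∈ (elems S̅ k) (λ z → eq-entry z (elt all k j)) _ (elems-unique S̅ k) (∈-elems-elt S̅ k i S̅x)))
      (+-identityˡ _)

  δ-entry-≰ : ∀ x y → ¬ (x ≤ y) → δ-entry x y ≈ 0h
  δ-entry-≰ x y x≰y with x ⋖? y
  ... | yes x⋖y = ⊥-elim (x≰y (proj₁ (proj₁ x⋖y)))
  ... | no _    = ≈-refl

  canon-chain : ∀ {S S'} → (∀ {x y} → T (S x) → T (S' y) → x ≤ y → T (S' x) × T (S y)) →
                ∀ k → δ S' k ∘ canon S S' k ≈ canon S S' (suc k) ∘ δ S k
  canon-chain {S} {S'} closed k = entries-determine (elems S k) (elems S' (suc k)) _ _ λ i j →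
    ≈-trans (matrix-∘-entry (elems S k) (elems S' k) (elems S' (suc k)) eq-entry δ-entry i j)
      (≈-trans (restrict-then-δ i j (decide (S' (x i))))
        (≈-sym (≈-trans (matrix-∘-entry (elems S k) (elems S (suc k)) (elems S' (suc k)) δ-entry eq-entry i j)
                        (δ-then-restrict i j (decide (S (y j)))))))
    where
    x : Fin (length (elems S k)) → Elt
    x = elt S k
    y : Fin (length (elems S' (suc k))) → Elt
    y = elt S' (suc k)
    restrict-then-δ : ∀ i j → T (S' (x i)) ⊎ T (not (S' (x i))) →
      hsum (length (elems S' k)) (λ l → δ-entry (elt S' k l) (y j) ∘ eq-entry (x i) (elt S' k l))
        ≈ δ-entry (x i) (y j)
    restrict-then-δ i j (inj₁ S'x) =
      select-right-∈ (elems S' k) (λ z → δ-entry z (y j)) _ (elems-unique S' k) (∈-elems-elt S' k i S'x)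
    restrict-then-δ i j (inj₂ ¬S'x) = ≈-trans
      (select-right-∉ (elems S' k) (λ z → δ-entry z (y j)) _ (∉-elems ¬S'x))
      (≈-sym (δ-entry-≰ _ _ λ x≤y → ∉-elems ¬S'x
        (∈-elems-elt S' k i (proj₁ (closed (elt-∈ S k i) (elt-∈ S' (suc k) j) x≤y)))))
    δ-then-restrict : ∀ i j → T (S (y j)) ⊎ T (not (S (y j))) →
      hsum (length (elems S (suc k))) (λ l → eq-entry (elt S (suc k) l) (y j) ∘ δ-entry (x i) (elt S (suc k) l))
        ≈ δ-entry (x i) (y j)
    δ-then-restrict i j (inj₁ Sy) =
      select-left-∈ (elems S (suc k)) (δ-entry (x i)) _ (elems-unique S (suc k)) (∈-elems-elt S (suc k) j Sy)
    δ-then-restrict i j (inj₂ ¬Sy) = ≈-trans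
      (select-left-∉ (elems S (suc k)) (δ-entry (x i)) _ (∉-elems ¬Sy))
      (≈-sym (δ-entry-≰ _ _ λ x≤y → ∉-elems ¬Sy
        (∈-elems-elt S (suc k) j (proj₂ (closed (elt-∈ S k i) (elt-∈ S' (suc k) j) x≤y)))))

module UpperIdealSequence {o ℓ e} (𝒜 : Abelian o ℓ e) (P : FinPoset)
    (G : PosetDefs.Grading P) (F : Functor P 𝒜) (c : PosetDefs.Coloring P)
    (I : PosetDefs.Elt P → Bool) (upper : PosetDefs.UpperIdeal P I) where
  open Abelian 𝒜
  open AbelianChase 𝒜
  open PosetDefs P
  open CochainComplex 𝒜 P G F c
  open Matrices 𝒜 P G F c
  open SplitLongExactSequence 𝒜

  all I̅ : Elt → Bool
  all _ = true
  I̅ x = not (I x)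

  I̅-lower : ∀ {x y} → T (I̅ y) → x ≤ y → T (I̅ x)
  I̅-lower {x} {y} I̅y x≤y with I x in Ix
  ... | true  = ⊥-elim (T-not⇒¬T (I y) I̅y (upper (subst T (sym Ix) tt) x≤y))
  ... | false = tt

  split : DegreewiseSplit (Cobj I) (Cobj all) (Cobj I̅) (δ I) (δ all) (δ I̅)
  split = record
    { ι = canon I all ; π = canon all I̅ ; t = canon all I ; s = canon I̅ all
    ; t∘ι     = λ k → ≈-trans (canon-comp (λ _ _ → tt) k) (canon-id I k)
    ; π∘s     = λ k → ≈-trans (canon-comp (λ _ _ → tt) k) (canon-id I̅ k)
    ; π∘ι     = λ k → ≈-trans (canon-comp (λ _ _ → tt) k)
                              (canon-disjoint (λ {x} Ix I̅x → T-not⇒¬T (I x) I̅x Ix) k)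
    ; ι∘t+s∘π = canon-partition I
    ; ι-chain = canon-chain λ Ix _ x≤y → tt , upper Ix x≤y
    ; π-chain = canon-chain λ _ I̅y x≤y → I̅-lower I̅y x≤y , tt }

-- Thinness,
-- diamond transitivity and balancedness are what make C*(P) a complex whose
-- cohomology is independent of c; here this is already encoded in the given
-- cohomology objects, and the sequence comes from the degreewise split
-- short exact sequence of restrictions.
mainTheorem18 : ∀ {o ℓ e} (𝒜 : Abelian o ℓ e) (P : FinPoset)
    (G : PosetDefs.Grading P) → PosetDefs.Thin P G →
    PosetDefs.DiamondTransitive P →
    (F : Functor P 𝒜) (c : PosetDefs.Coloring P) → PosetDefs.Balanced P c →
    (I : PosetDefs.Elt P → Bool) → PosetDefs.UpperIdeal P I →
    (hI : ∀ k → CochainComplex.Hcoh 𝒜 P G F c I k)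
    (hP : ∀ k → CochainComplex.Hcoh 𝒜 P G F c (λ _ → true) k)
    (hQ : ∀ k → CochainComplex.Hcoh 𝒜 P G F c (λ x → not (I x)) k) →
    CochainComplex.LongExactSequence 𝒜 P G F c I hI hP hQ
mainTheorem18 𝒜 P G _ _ F c _ I upper hI hP hQ = record
  { i = λ k → map (i k)
  ; r = λ k → map (r k)
  ; d = λ k → map (d k)
  ; i-induced = λ k → is-induced (i k)
  ; r-induced = λ k → is-induced (r k)
  ; exact-I₀ = i₀-mono
  ; exact-P  = exact-at-P
  ; exact-Q  = exact-at-Q
  ; exact-I  = exact-at-I }
  where
  open Cohomology 𝒜 using (is-induced; module CohomologyMap)
  open CohomologyMap using (map)
  open SplitLongExactSequence.LongExact 𝒜 (UpperIdealSequence.split 𝒜 P G F c I upper) hI hP hQ
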